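{- Let $\mathcal{Q}$ be the tiling $3.3.4.3.4$ and $\Gamma=[12,5]=\langle a,b,c\rangle$, acting on the flags of $\mathcal{Q}$ by the flag action. Let $\Phi$ be a flag of $\mathcal{Q}$ whose tile is a square and such that the tile of $\Phi^{cbc}$ is also a square. Put $\alpha_0=(ab)^4$, $\alpha_1=((ab)^3)^{c}$, $\alpha_2=\alpha_0^{cbc}$, $\alpha_3=((ab)^3)^{cbcbc}$, $\alpha_4=((ab)^3)^{cb}$, $\alpha_5=((ab)^3)^{cbac}$, $\beta=abcbabcbcb$, $\gamma=cabcbacbcbabcb$. Then $$\mathrm{Stab}_\Gamma(\Phi)=\big\langle \alpha_i^{\beta^j\gamma^k} : i\in\{0,\dots,5\},\ j,k\in\mathbb{Z}\big\rangle.$$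
   Context: The tiling $3.3.4.3.4$ (snub square tiling) is the edge-to-edge tiling of the Euclidean plane by regular triangles and squares in which every vertex is surrounded, in cyclic order, by triangle, triangle, square, triangle, square. It is regarded as an abstract polyhedron whose elements are its vertices, edges and tiles (plus least and greatest elements) ordered by incidence; a flag is an incident triple (vertex, edge, tile). For a flag $\Psi$, $\Psi^0,\Psi^1,\Psi^2$ denote the unique flags differing from $\Psi$ exactly in the vertex, the edge, the tile, respectively. $[p,q]$ denotes the Coxeter group $\langle \rho_0,\rho_1,\rho_2 \mid \rho_i^2=(\rho_0\rho_2)^2=(\rho_0\rho_1)^p=(\rho_1\rho_2)^q=\varepsilon\rangle$, and $a=\rho_0$, $b=\rho_1$, $c=\rho_2$. The flag action is the right action of $\Gamma$ on flags given by $\Psi^{\rho_i}=\Psi^i$ and $\Psi^{w\rho_i}=(\Psi^w)^i$ (well defined here); thus $\Phi^{cbc}=((\Phi^2)^1)^2$. $\mathrm{Stab}_\Gamma(\Phi)=\{g\in\Gamma:\Phi^g=\Phi\}$, and $w_1^{w_2}=w_2^{ -1}w_1w_2$. -}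

module Defs where

open import Data.Integer using (ℤ; +_; -[1+_]; _+_)
open import Data.Nat using (ℕ; zero; suc)
open import Data.Fin using (Fin; zero; suc)
open import Data.List using (List; []; _∷_; _++_; reverse)
open import Data.Product using (_×_; _,_; Σ; proj₁; proj₂)
open import Relation.Binary.PropositionalEquality using (_≡_)

-- The tiling is invariant under a square lattice of translations ℤ²
-- (period (2+√3)^(1/2) for unit edges).  A fundamental domain contains
-- 4 vertices, 10 edges, 6 tiles (4 triangles t0..t3, 2 squares t4,t5)
-- and 40 flags (4·6 + 2·8).  Every element of the tiling is
-- (translation (x , y) ∈ ℤ²) applied to an element of the fundamental
-- domain.  The tables below were generated from explicit coordinates:
-- square t4 centred at (0,0) rotated by 15°, square t5 centred at
-- (s/2,s/2) rotated by -15°, s = √(2+√3), edge length 1.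

data Shape : Set where
  triangle square : Shape

Displaced : Set → Set
Displaced A = ℤ × ℤ × A

data FlagIx : Set where
  f0 f1 f2 f3 f4 f5 f6 f7 f8 f9 f10 f11 f12 f13 f14 f15 f16 f17 f18 f19 f20 f21 f22 f23 f24 f25 f26 f27 f28 f29 f30 f31 f32 f33 f34 f35 f36 f37 f38 f39 : FlagIx

data VertexIx : Set where
  v0 v1 v2 v3 : VertexIx

data EdgeIx : Set where
  e0 e1 e2 e3 e4 e5 e6 e7 e8 e9 : EdgeIx

data TileIx : Set where
  t0 t1 t2 t3 t4 t5 : TileIx

tileShape : TileIx → Shape
tileShape t0 = triangle
tileShape t1 = triangle
tileShape t2 = triangle
tileShape t3 = triangle
tileShape t4 = square
tileShape t5 = square

flagVertex : FlagIx → Displaced VertexIx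
flagVertex f0 = (+ 0) , (+ 0) , v0
flagVertex f1 = (-[1+ 0 ]) , (+ 0) , v1
flagVertex f2 = (-[1+ 0 ]) , (+ 0) , v1
flagVertex f3 = (+ 0) , (+ 0) , v2
flagVertex f4 = (+ 0) , (+ 0) , v2
flagVertex f5 = (+ 0) , (+ 0) , v0
flagVertex f6 = (+ 0) , (+ 0) , v3
flagVertex f7 = (+ 0) , (+ 0) , v2
flagVertex f8 = (+ 0) , (+ 0) , v2
flagVertex f9 = (+ 0) , (-[1+ 0 ]) , v0
flagVertex f10 = (+ 0) , (-[1+ 0 ]) , v0
flagVertex f11 = (+ 0) , (+ 0) , v3
flagVertex f12 = (+ 0) , (+ 1) , v3
flagVertex f13 = (+ 0) , (+ 0) , v0
flagVertex f14 = (+ 0) , (+ 0) , v0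
flagVertex f15 = (+ 0) , (+ 0) , v1
flagVertex f16 = (+ 0) , (+ 0) , v1
flagVertex f17 = (+ 0) , (+ 1) , v3
flagVertex f18 = (+ 1) , (+ 0) , v2
flagVertex f19 = (+ 0) , (+ 0) , v1
flagVertex f20 = (+ 0) , (+ 0) , v1
flagVertex f21 = (+ 0) , (+ 0) , v3
flagVertex f22 = (+ 0) , (+ 0) , v3
flagVertex f23 = (+ 1) , (+ 0) , v2
flagVertex f24 = (+ 0) , (+ 0) , v2
flagVertex f25 = (-[1+ 0 ]) , (+ 0) , v3
flagVertex f26 = (-[1+ 0 ]) , (+ 0) , v3
flagVertex f27 = (-[1+ 0 ]) , (-[1+ 0 ]) , v1
flagVertex f28 = (-[1+ 0 ]) , (-[1+ 0 ]) , v1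
flagVertex f29 = (+ 0) , (-[1+ 0 ]) , v0
flagVertex f30 = (+ 0) , (-[1+ 0 ]) , v0
flagVertex f31 = (+ 0) , (+ 0) , v2
flagVertex f32 = (+ 0) , (+ 0) , v3
flagVertex f33 = (+ 0) , (+ 0) , v1
flagVertex f34 = (+ 0) , (+ 0) , v1
flagVertex f35 = (+ 0) , (+ 0) , v0
flagVertex f36 = (+ 0) , (+ 0) , v0
flagVertex f37 = (+ 0) , (+ 0) , v2
flagVertex f38 = (+ 0) , (+ 0) , v2
flagVertex f39 = (+ 0) , (+ 0) , v3

flagEdge : FlagIx → Displaced EdgeIx
flagEdge f0 = (+ 0) , (+ 0) , e0
flagEdge f1 = (+ 0) , (+ 0) , e0
flagEdge f2 = (+ 0) , (+ 0) , e1
flagEdge f3 = (+ 0) , (+ 0) , e1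
flagEdge f4 = (+ 0) , (+ 0) , e2
flagEdge f5 = (+ 0) , (+ 0) , e2
flagEdge f6 = (+ 0) , (+ 0) , e3
flagEdge f7 = (+ 0) , (+ 0) , e3
flagEdge f8 = (+ 0) , (+ 0) , e4
flagEdge f9 = (+ 0) , (+ 0) , e4
flagEdge f10 = (+ 0) , (+ 0) , e5
flagEdge f11 = (+ 0) , (+ 0) , e5
flagEdge f12 = (+ 0) , (+ 1) , e5
flagEdge f13 = (+ 0) , (+ 1) , e5
flagEdge f14 = (+ 0) , (+ 0) , e6
flagEdge f15 = (+ 0) , (+ 0) , e6
flagEdge f16 = (+ 0) , (+ 0) , e7
flagEdge f17 = (+ 0) , (+ 0) , e7
flagEdge f18 = (+ 1) , (+ 0) , e1
flagEdge f19 = (+ 1) , (+ 0) , e1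
flagEdge f20 = (+ 0) , (+ 0) , e8
flagEdge f21 = (+ 0) , (+ 0) , e8
flagEdge f22 = (+ 0) , (+ 0) , e9
flagEdge f23 = (+ 0) , (+ 0) , e9
flagEdge f24 = (-[1+ 0 ]) , (+ 0) , e9
flagEdge f25 = (-[1+ 0 ]) , (+ 0) , e9
flagEdge f26 = (-[1+ 0 ]) , (-[1+ 0 ]) , e7
flagEdge f27 = (-[1+ 0 ]) , (-[1+ 0 ]) , e7
flagEdge f28 = (+ 0) , (-[1+ 0 ]) , e0
flagEdge f29 = (+ 0) , (-[1+ 0 ]) , e0
flagEdge f30 = (+ 0) , (+ 0) , e4
flagEdge f31 = (+ 0) , (+ 0) , e4
flagEdge f32 = (+ 0) , (+ 0) , e8
flagEdge f33 = (+ 0) , (+ 0) , e8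
flagEdge f34 = (+ 0) , (+ 0) , e6
flagEdge f35 = (+ 0) , (+ 0) , e6
flagEdge f36 = (+ 0) , (+ 0) , e2
flagEdge f37 = (+ 0) , (+ 0) , e2
flagEdge f38 = (+ 0) , (+ 0) , e3
flagEdge f39 = (+ 0) , (+ 0) , e3

flagTile : FlagIx → TileIx
flagTile f0 = t0
flagTile f1 = t0
flagTile f2 = t0
flagTile f3 = t0
flagTile f4 = t0
flagTile f5 = t0
flagTile f6 = t1
flagTile f7 = t1
flagTile f8 = t1
flagTile f9 = t1
flagTile f10 = t1
flagTile f11 = t1
flagTile f12 = t2
flagTile f13 = t2
flagTile f14 = t2
flagTile f15 = t2
flagTile f16 = t2
flagTile f17 = t2
flagTile f18 = t3
flagTile f19 = t3
flagTile f20 = t3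
flagTile f21 = t3
flagTile f22 = t3
flagTile f23 = t3
flagTile f24 = t4
flagTile f25 = t4
flagTile f26 = t4
flagTile f27 = t4
flagTile f28 = t4
flagTile f29 = t4
flagTile f30 = t4
flagTile f31 = t4
flagTile f32 = t5
flagTile f33 = t5
flagTile f34 = t5
flagTile f35 = t5
flagTile f36 = t5
flagTile f37 = t5
flagTile f38 = t5
flagTile f39 = t5

adj0 : FlagIx → Displaced FlagIx
adj0 f0 = (+ 0) , (+ 0) , f1
adj0 f1 = (+ 0) , (+ 0) , f0
adj0 f2 = (+ 0) , (+ 0) , f3
adj0 f3 = (+ 0) , (+ 0) , f2
adj0 f4 = (+ 0) , (+ 0) , f5
adj0 f5 = (+ 0) , (+ 0) , f4
adj0 f6 = (+ 0) , (+ 0) , f7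
adj0 f7 = (+ 0) , (+ 0) , f6
adj0 f8 = (+ 0) , (+ 0) , f9
adj0 f9 = (+ 0) , (+ 0) , f8
adj0 f10 = (+ 0) , (+ 0) , f11
adj0 f11 = (+ 0) , (+ 0) , f10
adj0 f12 = (+ 0) , (+ 0) , f13
adj0 f13 = (+ 0) , (+ 0) , f12
adj0 f14 = (+ 0) , (+ 0) , f15
adj0 f15 = (+ 0) , (+ 0) , f14
adj0 f16 = (+ 0) , (+ 0) , f17
adj0 f17 = (+ 0) , (+ 0) , f16
adj0 f18 = (+ 0) , (+ 0) , f19
adj0 f19 = (+ 0) , (+ 0) , f18
adj0 f20 = (+ 0) , (+ 0) , f21
adj0 f21 = (+ 0) , (+ 0) , f20
adj0 f22 = (+ 0) , (+ 0) , f23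
adj0 f23 = (+ 0) , (+ 0) , f22
adj0 f24 = (+ 0) , (+ 0) , f25
adj0 f25 = (+ 0) , (+ 0) , f24
adj0 f26 = (+ 0) , (+ 0) , f27
adj0 f27 = (+ 0) , (+ 0) , f26
adj0 f28 = (+ 0) , (+ 0) , f29
adj0 f29 = (+ 0) , (+ 0) , f28
adj0 f30 = (+ 0) , (+ 0) , f31
adj0 f31 = (+ 0) , (+ 0) , f30
adj0 f32 = (+ 0) , (+ 0) , f33
adj0 f33 = (+ 0) , (+ 0) , f32
adj0 f34 = (+ 0) , (+ 0) , f35
adj0 f35 = (+ 0) , (+ 0) , f34
adj0 f36 = (+ 0) , (+ 0) , f37
adj0 f37 = (+ 0) , (+ 0) , f36
adj0 f38 = (+ 0) , (+ 0) , f39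
adj0 f39 = (+ 0) , (+ 0) , f38

adj1 : FlagIx → Displaced FlagIx
adj1 f0 = (+ 0) , (+ 0) , f5
adj1 f1 = (+ 0) , (+ 0) , f2
adj1 f2 = (+ 0) , (+ 0) , f1
adj1 f3 = (+ 0) , (+ 0) , f4
adj1 f4 = (+ 0) , (+ 0) , f3
adj1 f5 = (+ 0) , (+ 0) , f0
adj1 f6 = (+ 0) , (+ 0) , f11
adj1 f7 = (+ 0) , (+ 0) , f8
adj1 f8 = (+ 0) , (+ 0) , f7
adj1 f9 = (+ 0) , (+ 0) , f10
adj1 f10 = (+ 0) , (+ 0) , f9
adj1 f11 = (+ 0) , (+ 0) , f6
adj1 f12 = (+ 0) , (+ 0) , f17
adj1 f13 = (+ 0) , (+ 0) , f14
adj1 f14 = (+ 0) , (+ 0) , f13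
adj1 f15 = (+ 0) , (+ 0) , f16
adj1 f16 = (+ 0) , (+ 0) , f15
adj1 f17 = (+ 0) , (+ 0) , f12
adj1 f18 = (+ 0) , (+ 0) , f23
adj1 f19 = (+ 0) , (+ 0) , f20
adj1 f20 = (+ 0) , (+ 0) , f19
adj1 f21 = (+ 0) , (+ 0) , f22
adj1 f22 = (+ 0) , (+ 0) , f21
adj1 f23 = (+ 0) , (+ 0) , f18
adj1 f24 = (+ 0) , (+ 0) , f31
adj1 f25 = (+ 0) , (+ 0) , f26
adj1 f26 = (+ 0) , (+ 0) , f25
adj1 f27 = (+ 0) , (+ 0) , f28
adj1 f28 = (+ 0) , (+ 0) , f27
adj1 f29 = (+ 0) , (+ 0) , f30
adj1 f30 = (+ 0) , (+ 0) , f29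
adj1 f31 = (+ 0) , (+ 0) , f24
adj1 f32 = (+ 0) , (+ 0) , f39
adj1 f33 = (+ 0) , (+ 0) , f34
adj1 f34 = (+ 0) , (+ 0) , f33
adj1 f35 = (+ 0) , (+ 0) , f36
adj1 f36 = (+ 0) , (+ 0) , f35
adj1 f37 = (+ 0) , (+ 0) , f38
adj1 f38 = (+ 0) , (+ 0) , f37
adj1 f39 = (+ 0) , (+ 0) , f32

adj2 : FlagIx → Displaced FlagIx
adj2 f0 = (+ 0) , (+ 1) , f29
adj2 f1 = (+ 0) , (+ 1) , f28
adj2 f2 = (-[1+ 0 ]) , (+ 0) , f19
adj2 f3 = (-[1+ 0 ]) , (+ 0) , f18
adj2 f4 = (+ 0) , (+ 0) , f37
adj2 f5 = (+ 0) , (+ 0) , f36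
adj2 f6 = (+ 0) , (+ 0) , f39
adj2 f7 = (+ 0) , (+ 0) , f38
adj2 f8 = (+ 0) , (+ 0) , f31
adj2 f9 = (+ 0) , (+ 0) , f30
adj2 f10 = (+ 0) , (-[1+ 0 ]) , f13
adj2 f11 = (+ 0) , (-[1+ 0 ]) , f12
adj2 f12 = (+ 0) , (+ 1) , f11
adj2 f13 = (+ 0) , (+ 1) , f10
adj2 f14 = (+ 0) , (+ 0) , f35
adj2 f15 = (+ 0) , (+ 0) , f34
adj2 f16 = (+ 1) , (+ 1) , f27
adj2 f17 = (+ 1) , (+ 1) , f26
adj2 f18 = (+ 1) , (+ 0) , f3
adj2 f19 = (+ 1) , (+ 0) , f2
adj2 f20 = (+ 0) , (+ 0) , f33
adj2 f21 = (+ 0) , (+ 0) , f32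
adj2 f22 = (+ 1) , (+ 0) , f25
adj2 f23 = (+ 1) , (+ 0) , f24
adj2 f24 = (-[1+ 0 ]) , (+ 0) , f23
adj2 f25 = (-[1+ 0 ]) , (+ 0) , f22
adj2 f26 = (-[1+ 0 ]) , (-[1+ 0 ]) , f17
adj2 f27 = (-[1+ 0 ]) , (-[1+ 0 ]) , f16
adj2 f28 = (+ 0) , (-[1+ 0 ]) , f1
adj2 f29 = (+ 0) , (-[1+ 0 ]) , f0
adj2 f30 = (+ 0) , (+ 0) , f9
adj2 f31 = (+ 0) , (+ 0) , f8
adj2 f32 = (+ 0) , (+ 0) , f21
adj2 f33 = (+ 0) , (+ 0) , f20
adj2 f34 = (+ 0) , (+ 0) , f15
adj2 f35 = (+ 0) , (+ 0) , f14
adj2 f36 = (+ 0) , (+ 0) , f5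
adj2 f37 = (+ 0) , (+ 0) , f4
adj2 f38 = (+ 0) , (+ 0) , f7
adj2 f39 = (+ 0) , (+ 0) , f6

Flag : Set
Flag = Displaced FlagIx

translate : {A : Set} → ℤ → ℤ → Displaced A → Displaced A
translate x y (dx , dy , a) = (x + dx) , (y + dy) , a

vertexOf : Flag → Displaced VertexIx
vertexOf (x , y , k) = translate x y (flagVertex k)

edgeOf : Flag → Displaced EdgeIx
edgeOf (x , y , k) = translate x y (flagEdge k)

tileOf : Flag → Displaced TileIx
tileOf (x , y , k) = x , y , flagTile k

IsSquareTile : Displaced TileIx → Set
IsSquareTile (_ , _ , t) = tileShape t ≡ square

-- Ψ^i : the i-adjacent flag (differs from Ψ exactly in the i-face)
adjTable : Fin 3 → FlagIx → Displaced FlagIx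
adjTable zero = adj0
adjTable (suc zero) = adj1
adjTable (suc (suc zero)) = adj2

adjacent : Fin 3 → Flag → Flag
adjacent i (x , y , k) = translate x y (adjTable i k)

-- The Coxeter group [p,q] = ⟨ρ₀,ρ₁,ρ₂⟩, elements represented by words
-- in the generators modulo the defining relations.

Word : Set
Word = List (Fin 3)

a b c : Fin 3
a = zero
b = suc zero
c = suc (suc zero)

_^ⁿ_ : Word → ℕ → Word
w ^ⁿ zero = []
w ^ⁿ suc n = w ++ (w ^ⁿ n)

-- inverse of a word (generators are involutions)
inv : Word → Word
inv = reverse

_^ᶻ_ : Word → ℤ → Word
w ^ᶻ (+ n) = w ^ⁿ n
w ^ᶻ (-[1+ n ]) = inv w ^ⁿ suc n

_^ᶜ_ : Word → Word → Word
w₁ ^ᶜ w₂ = inv w₂ ++ w₁ ++ w₂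

data Relator (p q : ℕ) : Word → Set where
  r-a  : Relator p q (a ∷ a ∷ [])
  r-b  : Relator p q (b ∷ b ∷ [])
  r-c  : Relator p q (c ∷ c ∷ [])
  r-ac : Relator p q ((a ∷ c ∷ []) ^ⁿ 2)
  r-ab : Relator p q ((a ∷ b ∷ []) ^ⁿ p)
  r-bc : Relator p q ((b ∷ c ∷ []) ^ⁿ q)

data _≈[_,_]_ : Word → ℕ → ℕ → Word → Set where
  ≈refl  : ∀ {p q w} → w ≈[ p , q ] w
  ≈sym   : ∀ {p q u v} → u ≈[ p , q ] v → v ≈[ p , q ] u
  ≈trans : ∀ {p q u v w} → u ≈[ p , q ] v → v ≈[ p , q ] w → u ≈[ p , q ] w
  ≈rel   : ∀ {p q r} u v → Relator p q r → (u ++ r ++ v) ≈[ p , q ] (u ++ v)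

data InSubgroup (p q : ℕ) {I : Set} (gen : I → Word) : Word → Set where
  sg-gen  : ∀ i → InSubgroup p q gen (gen i)
  sg-one  : InSubgroup p q gen []
  sg-mul  : ∀ {u v} → InSubgroup p q gen u → InSubgroup p q gen v
            → InSubgroup p q gen (u ++ v)
  sg-inv  : ∀ {u} → InSubgroup p q gen u → InSubgroup p q gen (inv u)
  sg-resp : ∀ {u v} → u ≈[ p , q ] v → InSubgroup p q gen u
            → InSubgroup p q gen v

_·_ : Flag → Word → Flag
Ψ · [] = Ψ
Ψ · (i ∷ w) = adjacent i Ψ · w

InStab : Flag → Word → Set
InStab Φ w = Φ · w ≡ Φ

ab : Word
ab = a ∷ b ∷ []

cbc : Word
cbc = c ∷ b ∷ c ∷ []

α₀ α₁ α₂ α₃ α₄ α₅ β γ : Word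
α₀ = ab ^ⁿ 4
α₁ = (ab ^ⁿ 3) ^ᶜ (c ∷ [])
α₂ = α₀ ^ᶜ cbc
α₃ = (ab ^ⁿ 3) ^ᶜ (c ∷ b ∷ c ∷ b ∷ c ∷ [])
α₄ = (ab ^ⁿ 3) ^ᶜ (c ∷ b ∷ [])
α₅ = (ab ^ⁿ 3) ^ᶜ (c ∷ b ∷ a ∷ c ∷ [])
β = a ∷ b ∷ c ∷ b ∷ a ∷ b ∷ c ∷ b ∷ c ∷ b ∷ []
γ = c ∷ a ∷ b ∷ c ∷ b ∷ a ∷ c ∷ b ∷ c ∷ b ∷ a ∷ b ∷ c ∷ b ∷ []

α : Fin 6 → Word
α zero = α₀
α (suc zero) = α₁
α (suc (suc zero)) = α₂
α (suc (suc (suc zero))) = α₃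
α (suc (suc (suc (suc zero)))) = α₄
α (suc (suc (suc (suc (suc zero))))) = α₅

stabGen : Fin 6 × ℤ × ℤ → Word
stabGen (i , j , k) = α i ^ᶜ ((β ^ᶻ j) ++ (γ ^ᶻ k))

module Submission where

-- Write Φ₀ for the flag f25 of the square t4.  The words β and γ act on the translates of Φ₀
-- as the lattice translations by (1, 0) and (1, 1), and each α_i fixes Φ₀; hence every
-- generator α_i^{β^j γ^k} fixes Φ₀.  Conversely, let t(Ψ) be a lattice word in β, γ followed
-- by a fixed path inside the fundamental domain, so that t(Φ₀) is empty.  A word fixing Φ₀
-- is a product of Schreier generators t(Ψ) ρ_i t(Ψ^i)⁻¹.  Modulo conjugation by lattice
-- words these are the 120 generators attached to the fundamental flags, each of which is
-- exhibited as a product of the α_i^{β^j γ^k} by a rewriting normal form in [12, 5]; the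
-- conjugations are absorbed because the subgroup is normalized by β and γ and contains
-- every commutator [β^J, γ^K].  Finally the eight square flags Φ with Φ^{cbc} in a square
-- are carried onto Φ₀ and back by a quarter turn and a reflection of the tiling, and
-- symmetries commute with the flag action, so all eight have the same stabilizer.

open import Defs
open import Data.Bool using (Bool; true; false; T; if_then_else_)
open import Data.Fin using (Fin; zero; suc; #_)
import Data.Fin as Fin
open import Data.Integer using (ℤ; +_; -[1+_]; _+_; _-_; -_; _*_; 1ℤ; -1ℤ; pred)
  renaming (suc to sucℤ)
import Data.Integer.Properties as ℤ
open import Data.Integer.Tactic.RingSolver using (solve-∀)
open import Data.List using (List; []; _∷_; _++_; [_]; reverse; foldr)
open import Data.List.Properties
  using (++-assoc; ++-identityʳ; reverse-++; reverse-involutive; unfold-reverse)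
open import Data.List.Relation.Unary.All using (All; []; _∷_)
open import Data.Maybe using (Maybe; just; nothing)
open import Data.Nat using (ℕ; zero; suc; _≡ᵇ_)
open import Data.Nat.Properties using (≡ᵇ⇒≡)
open import Data.Product using (_×_; _,_; Σ-syntax; proj₁; proj₂; uncurry)
open import Function.Bundles using (_⇔_; mk⇔)
open import Relation.Binary.Bundles using (Setoid)
import Relation.Binary.Reasoning.Setoid as SetoidReasoning
open import Relation.Binary.PropositionalEquality
  using (_≡_; refl; sym; trans; cong; cong₂; subst; subst₂; module ≡-Reasoning)
open import Relation.Nullary using (yes; no)

-- Equality of words in [p, q]

module Congruence (p q : ℕ) where

  infix 4 _≈_
  _≈_ : Word → Word → Set
  u ≈ v = u ≈[ p , q ] v

  ≈-reflexive : ∀ {u v} → u ≡ v → u ≈ v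
  ≈-reflexive refl = ≈refl

  setoid : Setoid _ _
  setoid = record
    { Carrier = Word
    ; _≈_ = _≈_
    ; isEquivalence = record { refl = ≈refl ; sym = ≈sym ; trans = ≈trans }
    }

  ≈-congˡ : ∀ l {u v} → u ≈ v → l ++ u ≈ l ++ v
  ≈-congˡ l ≈refl = ≈refl
  ≈-congˡ l (≈sym e) = ≈sym (≈-congˡ l e)
  ≈-congˡ l (≈trans e f) = ≈trans (≈-congˡ l e) (≈-congˡ l f)
  ≈-congˡ l (≈rel {r = ρ} u v rel) =
    subst₂ _≈_ (++-assoc l u (ρ ++ v)) (++-assoc l u v) (≈rel (l ++ u) v rel)

  ≈-congʳ : ∀ r {u v} → u ≈ v → u ++ r ≈ v ++ r
  ≈-congʳ r ≈refl = ≈refl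
  ≈-congʳ r (≈sym e) = ≈sym (≈-congʳ r e)
  ≈-congʳ r (≈trans e f) = ≈trans (≈-congʳ r e) (≈-congʳ r f)
  ≈-congʳ r (≈rel {r = ρ} u v rel) =
    subst₂ _≈_ reassoc (sym (++-assoc u v r)) (≈rel u (v ++ r) rel)
    where
    reassoc : u ++ ρ ++ v ++ r ≡ (u ++ ρ ++ v) ++ r
    reassoc = sym (trans (++-assoc u (ρ ++ v) r) (cong (u ++_) (++-assoc ρ v r)))

  ≈-cong : ∀ l r {u v} → u ≈ v → l ++ u ++ r ≈ l ++ v ++ r
  ≈-cong l r u≈v = ≈-congˡ l (≈-congʳ r u≈v)

  ≈-++ : ∀ {u u′ v v′} → u ≈ u′ → v ≈ v′ → u ++ v ≈ u′ ++ v′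
  ≈-++ {u′ = u′} {v = v} e f = ≈trans (≈-congʳ v e) (≈-congˡ u′ f)

  generator-involutive : ∀ x → x ∷ x ∷ [] ≈ []
  generator-involutive zero = ≈rel [] [] r-a
  generator-involutive (suc zero) = ≈rel [] [] r-b
  generator-involutive (suc (suc zero)) = ≈rel [] [] r-c

  ++-inverseʳ : ∀ w → w ++ inv w ≈ []
  ++-inverseʳ [] = ≈refl
  ++-inverseʳ (x ∷ w) =
    ≈trans (≈-reflexive (cong (x ∷_) reassoc))
      (≈trans (≈-congˡ [ x ] (≈-congʳ [ x ] (++-inverseʳ w))) (generator-involutive x))
    where
    reassoc : w ++ inv (x ∷ w) ≡ (w ++ inv w) ++ [ x ]
    reassoc = trans (cong (w ++_) (unfold-reverse x w)) (sym (++-assoc w (inv w) [ x ]))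

  ++-inverseˡ : ∀ w → inv w ++ w ≈ []
  ++-inverseˡ w = subst (λ v → inv w ++ v ≈ []) (reverse-involutive w) (++-inverseʳ (inv w))

  inverseˡ-unique : ∀ u v → u ++ v ≈ [] → u ≈ inv v
  inverseˡ-unique u v uv≈ε = begin
    u                  ≡⟨ ++-identityʳ u ⟨
    u ++ []            ≈⟨ ≈-congˡ u (≈sym (++-inverseʳ v)) ⟩
    u ++ v ++ inv v    ≡⟨ ++-assoc u v (inv v) ⟨
    (u ++ v) ++ inv v  ≈⟨ ≈-congʳ (inv v) uv≈ε ⟩
    inv v              ∎
    where open SetoidReasoning setoid

  inv-cong : ∀ {u v} → u ≈ v → inv u ≈ inv v
  inv-cong {u} {v} u≈v =
    inverseˡ-unique (inv u) v (≈trans (≈-congˡ (inv u) (≈sym u≈v)) (++-inverseˡ u))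

  ^ᶜ-congˡ : ∀ g {u v} → u ≈ v → u ^ᶜ g ≈ v ^ᶜ g
  ^ᶜ-congˡ g = ≈-cong (inv g) g

  ^ᶜ-congʳ : ∀ u {g h} → g ≈ h → u ^ᶜ g ≈ u ^ᶜ h
  ^ᶜ-congʳ u g≈h = ≈-++ (inv-cong g≈h) (≈-congˡ u g≈h)

  cancelʳ : ∀ w u → w ++ inv w ++ u ≈ u
  cancelʳ w u = ≈trans (≈-reflexive (sym (++-assoc w (inv w) u))) (≈-congʳ u (++-inverseʳ w))

  cancelˡ : ∀ w u → inv w ++ w ++ u ≈ u
  cancelˡ w u = ≈trans (≈-reflexive (sym (++-assoc (inv w) w u))) (≈-congʳ u (++-inverseˡ w))

  inv-^ⁿ : ∀ w n → inv (w ^ⁿ n) ≡ inv w ^ⁿ n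
  inv-^ⁿ w zero = refl
  inv-^ⁿ w (suc n) = begin
    inv (w ++ w ^ⁿ n)      ≡⟨ reverse-++ w (w ^ⁿ n) ⟩
    inv (w ^ⁿ n) ++ inv w  ≡⟨ cong (_++ inv w) (inv-^ⁿ w n) ⟩
    inv w ^ⁿ n ++ inv w    ≡⟨ ^ⁿ-snoc (inv w) n ⟨
    inv w ^ⁿ suc n         ∎
    where
    open ≡-Reasoning
    ^ⁿ-snoc : ∀ v n → v ^ⁿ suc n ≡ v ^ⁿ n ++ v
    ^ⁿ-snoc v zero = ++-identityʳ v
    ^ⁿ-snoc v (suc n) = trans (cong (v ++_) (^ⁿ-snoc v n)) (sym (++-assoc v (v ^ⁿ n) v))

  inv-^ᶻ : ∀ w m → inv (w ^ᶻ m) ≡ inv w ^ᶻ m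
  inv-^ᶻ w (+ n) = inv-^ⁿ w n
  inv-^ᶻ w -[1+ n ] = inv-^ⁿ (inv w) (suc n)

  ^ᶻ-suc : ∀ w m → w ^ᶻ sucℤ m ≈ w ++ w ^ᶻ m
  ^ᶻ-suc w (+ n) = ≈refl
  ^ᶻ-suc w -[1+ zero ] = ≈sym (≈trans (≈-congˡ w (≈-reflexive (++-identityʳ (inv w)))) (++-inverseʳ w))
  ^ᶻ-suc w -[1+ suc n ] = ≈sym (cancelʳ w (inv w ^ⁿ suc n))

  ^ᶻ-pred : ∀ w m → w ^ᶻ pred m ≈ inv w ++ w ^ᶻ m
  ^ᶻ-pred w (+ zero) = ≈refl
  ^ᶻ-pred w (+ suc n) = ≈sym (cancelˡ w (w ^ⁿ n))
  ^ᶻ-pred w -[1+ n ] = ≈refl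

  ^ᶻ-+ : ∀ w m n → w ^ᶻ (m + n) ≈ w ^ᶻ m ++ w ^ᶻ n
  ^ᶻ-+ w (+ zero) n = ≈-reflexive (cong (w ^ᶻ_) (ℤ.+-identityˡ n))
  ^ᶻ-+ w (+ suc k) n = begin
    w ^ᶻ (+ suc k + n)          ≡⟨ cong (w ^ᶻ_) (ℤ.+-assoc 1ℤ (+ k) n) ⟩
    w ^ᶻ sucℤ (+ k + n)         ≈⟨ ^ᶻ-suc w (+ k + n) ⟩
    w ++ w ^ᶻ (+ k + n)         ≈⟨ ≈-congˡ w (^ᶻ-+ w (+ k) n) ⟩
    w ++ w ^ⁿ k ++ w ^ᶻ n       ≡⟨ ++-assoc w (w ^ⁿ k) (w ^ᶻ n) ⟨
    w ^ⁿ suc k ++ w ^ᶻ n        ∎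
    where open SetoidReasoning setoid
  ^ᶻ-+ w -[1+ zero ] n =
    ≈trans (^ᶻ-pred w n) (≈-reflexive (cong (_++ w ^ᶻ n) (sym (++-identityʳ (inv w)))))
  ^ᶻ-+ w -[1+ suc k ] n = begin
    w ^ᶻ (-[1+ suc k ] + n)                  ≡⟨ cong (w ^ᶻ_) (ℤ.+-assoc -1ℤ -[1+ k ] n) ⟩
    w ^ᶻ pred (-[1+ k ] + n)                 ≈⟨ ^ᶻ-pred w (-[1+ k ] + n) ⟩
    inv w ++ w ^ᶻ (-[1+ k ] + n)             ≈⟨ ≈-congˡ (inv w) (^ᶻ-+ w -[1+ k ] n) ⟩
    inv w ++ inv w ^ⁿ suc k ++ w ^ᶻ n        ≡⟨ ++-assoc (inv w) (inv w ^ⁿ suc k) (w ^ᶻ n) ⟨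
    inv w ^ⁿ suc (suc k) ++ w ^ᶻ n           ∎
    where open SetoidReasoning setoid

-- Identities of the free group

module FreeGroupSolver (p q : ℕ) where
  open Congruence p q

  infixr 5 _⊕_
  infix 6 _⁻¹
  data Expr : Set where
    var : ℕ → Expr
    ε : Expr
    _⊕_ : Expr → Expr → Expr
    _⁻¹ : Expr → Expr

  data Atom : Set where
    var⁺ var⁻ : ℕ → Atom

  atom-inv : Atom → Atom
  atom-inv (var⁺ i) = var⁻ i
  atom-inv (var⁻ i) = var⁺ i

  atoms-inv : List Atom → List Atom
  atoms-inv [] = []
  atoms-inv (x ∷ xs) = atoms-inv xs ++ [ atom-inv x ]

  atoms : Expr → List Atom
  atoms (var i) = [ var⁺ i ]
  atoms ε = []
  atoms (e ⊕ f) = atoms e ++ atoms f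
  atoms (e ⁻¹) = atoms-inv (atoms e)

  cancels : Atom → Atom → Bool
  cancels (var⁺ i) (var⁻ j) = i ≡ᵇ j
  cancels (var⁻ i) (var⁺ j) = i ≡ᵇ j
  cancels _ _ = false

  push : Atom → List Atom → List Atom
  push x [] = [ x ]
  push x (y ∷ xs) = if cancels x y then xs else x ∷ y ∷ xs

  normalise : Expr → List Atom
  normalise e = foldr push [] (atoms e)

  module _ (env : List Word) where

    value : ℕ → Word
    value = go env
      where
      go : List Word → ℕ → Word
      go [] _ = []
      go (w ∷ _) zero = w
      go (_ ∷ ws) (suc i) = go ws i

    ⟦_⟧ : Expr → Word
    ⟦ var i ⟧ = value i
    ⟦ ε ⟧ = []
    ⟦ e ⊕ f ⟧ = ⟦ e ⟧ ++ ⟦ f ⟧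
    ⟦ e ⁻¹ ⟧ = inv ⟦ e ⟧

    ⟦_⟧ₐ : Atom → Word
    ⟦ var⁺ i ⟧ₐ = value i
    ⟦ var⁻ i ⟧ₐ = inv (value i)

    ⟦_⟧* : List Atom → Word
    ⟦ xs ⟧* = foldr (λ x w → ⟦ x ⟧ₐ ++ w) [] xs

    ⟦⟧*-++ : ∀ xs ys → ⟦ xs ++ ys ⟧* ≡ ⟦ xs ⟧* ++ ⟦ ys ⟧*
    ⟦⟧*-++ [] ys = refl
    ⟦⟧*-++ (x ∷ xs) ys = trans (cong (⟦ x ⟧ₐ ++_) (⟦⟧*-++ xs ys)) (sym (++-assoc ⟦ x ⟧ₐ ⟦ xs ⟧* ⟦ ys ⟧*))

    atom-inv-sound : ∀ x → ⟦ atom-inv x ⟧ₐ ≡ inv ⟦ x ⟧ₐ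
    atom-inv-sound (var⁺ i) = refl
    atom-inv-sound (var⁻ i) = sym (reverse-involutive (value i))

    atoms-inv-sound : ∀ xs → ⟦ atoms-inv xs ⟧* ≡ inv ⟦ xs ⟧*
    atoms-inv-sound [] = refl
    atoms-inv-sound (x ∷ xs) = begin
      ⟦ atoms-inv xs ++ [ atom-inv x ] ⟧*       ≡⟨ ⟦⟧*-++ (atoms-inv xs) [ atom-inv x ] ⟩
      ⟦ atoms-inv xs ⟧* ++ ⟦ atom-inv x ⟧ₐ ++ []  ≡⟨ cong₂ _++_ (atoms-inv-sound xs) (++-identityʳ _) ⟩
      inv ⟦ xs ⟧* ++ ⟦ atom-inv x ⟧ₐ            ≡⟨ cong (inv ⟦ xs ⟧* ++_) (atom-inv-sound x) ⟩
      inv ⟦ xs ⟧* ++ inv ⟦ x ⟧ₐ                 ≡⟨ reverse-++ ⟦ x ⟧ₐ ⟦ xs ⟧* ⟨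
      inv (⟦ x ⟧ₐ ++ ⟦ xs ⟧*)                   ∎
      where open ≡-Reasoning

    atoms-sound : ∀ e → ⟦ atoms e ⟧* ≡ ⟦ e ⟧
    atoms-sound (var i) = ++-identityʳ (value i)
    atoms-sound ε = refl
    atoms-sound (e ⊕ f) = trans (⟦⟧*-++ (atoms e) (atoms f)) (cong₂ _++_ (atoms-sound e) (atoms-sound f))
    atoms-sound (e ⁻¹) = trans (atoms-inv-sound (atoms e)) (cong inv (atoms-sound e))

    cancels-sound : ∀ x y → T (cancels x y) → ⟦ x ⟧ₐ ++ ⟦ y ⟧ₐ ≈ []
    cancels-sound (var⁺ i) (var⁻ j) i≡j rewrite ≡ᵇ⇒≡ i j i≡j = ++-inverseʳ (value j)
    cancels-sound (var⁻ i) (var⁺ j) i≡j rewrite ≡ᵇ⇒≡ i j i≡j = ++-inverseˡ (value j)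

    push-sound : ∀ x xs → ⟦ push x xs ⟧* ≈ ⟦ x ⟧ₐ ++ ⟦ xs ⟧*
    push-sound x [] = ≈refl
    push-sound x (y ∷ xs) with cancels x y | cancels-sound x y
    ... | true | x·y≈ε = ≈sym (≈trans (≈-reflexive (sym (++-assoc ⟦ x ⟧ₐ ⟦ y ⟧ₐ ⟦ xs ⟧*)))
                                      (≈-congʳ ⟦ xs ⟧* (x·y≈ε _)))
    ... | false | _ = ≈refl

    normalise-sound : ∀ e → ⟦ normalise e ⟧* ≈ ⟦ e ⟧
    normalise-sound e = ≈trans (push-all-sound (atoms e)) (≈-reflexive (atoms-sound e))
      where
      push-all-sound : ∀ xs → ⟦ foldr push [] xs ⟧* ≈ ⟦ xs ⟧*
      push-all-sound [] = ≈refl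
      push-all-sound (x ∷ xs) = ≈trans (push-sound x (foldr push [] xs)) (≈-congˡ ⟦ x ⟧ₐ (push-all-sound xs))

    solve : ∀ e f → normalise e ≡ normalise f → ⟦ e ⟧ ≈ ⟦ f ⟧
    solve e f e≡f =
      ≈trans (≈sym (normalise-sound e)) (≈trans (≈-reflexive (cong ⟦_⟧* e≡f)) (normalise-sound f))

-- Subgroups generated by words

module Subgroup (p q : ℕ) {I : Set} (gen : I → Word) where
  open Congruence p q
  open FreeGroupSolver p q

  Sub : Word → Set
  Sub = InSubgroup p q gen

  Sub-^ᶜ : ∀ {h u} → Sub h → Sub u → Sub (u ^ᶜ h)
  Sub-^ᶜ h∈ u∈ = sg-mul (sg-inv h∈) (sg-mul u∈ h∈)

  record Normalizes (g : Word) : Set where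
    constructor normalizes
    field ^ᶜ-closed : ∀ {u} → Sub u → Sub (u ^ᶜ g)
  open Normalizes public

  normalizes-generators : ∀ {g} → (∀ x → Sub (gen x ^ᶜ g)) → Normalizes g
  normalizes-generators {g} gen^g = normalizes closed
    where
    closed : ∀ {u} → Sub u → Sub (u ^ᶜ g)
    closed (sg-gen x) = gen^g x
    closed sg-one = sg-resp (≈sym (solve (g ∷ []) (var 0 ⁻¹ ⊕ ε ⊕ var 0) ε refl)) sg-one
    closed (sg-mul {u} {v} u∈ v∈) =
      sg-resp (solve (u ∷ v ∷ g ∷ [])
                     ((var 2 ⁻¹ ⊕ var 0 ⊕ var 2) ⊕ (var 2 ⁻¹ ⊕ var 1 ⊕ var 2))
                     (var 2 ⁻¹ ⊕ (var 0 ⊕ var 1) ⊕ var 2) refl)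
              (sg-mul (closed u∈) (closed v∈))
    closed (sg-inv {u} u∈) =
      sg-resp (solve (u ∷ g ∷ []) ((var 1 ⁻¹ ⊕ var 0 ⊕ var 1) ⁻¹) (var 1 ⁻¹ ⊕ var 0 ⁻¹ ⊕ var 1) refl)
              (sg-inv (closed u∈))
    closed (sg-resp u≈v u∈) = sg-resp (≈-congˡ (inv g) (≈-congʳ g u≈v)) (closed u∈)

  normalizes-++ : ∀ {g h} → Normalizes g → Normalizes h → Normalizes (g ++ h)
  normalizes-++ {g} {h} ng nh = normalizes λ {u} u∈ →
    sg-resp (solve (u ∷ g ∷ h ∷ [])
                   (var 2 ⁻¹ ⊕ (var 1 ⁻¹ ⊕ var 0 ⊕ var 1) ⊕ var 2)
                   ((var 1 ⊕ var 2) ⁻¹ ⊕ var 0 ⊕ var 1 ⊕ var 2) refl)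
            (^ᶜ-closed nh (^ᶜ-closed ng u∈))

  normalizes-^ⁿ : ∀ {g} → Normalizes g → ∀ n → Normalizes (g ^ⁿ n)
  normalizes-^ⁿ ng zero = normalizes λ {u} u∈ →
    sg-resp (solve (u ∷ []) (var 0) (ε ⁻¹ ⊕ var 0 ⊕ ε) refl) u∈
  normalizes-^ⁿ ng (suc n) = normalizes-++ ng (normalizes-^ⁿ ng n)

  normalizes-^ᶻ : ∀ {g} → Normalizes g → Normalizes (inv g) → ∀ m → Normalizes (g ^ᶻ m)
  normalizes-^ᶻ ng ng⁻¹ (+ n) = normalizes-^ⁿ ng n
  normalizes-^ᶻ ng ng⁻¹ -[1+ n ] = normalizes-^ⁿ ng⁻¹ (suc n)

  commutator : Word → Word → Word
  commutator u v = inv u ++ inv v ++ u ++ v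

  commutator-swap : ∀ u v → Sub (commutator u v) → Sub (commutator v u)
  commutator-swap u v c∈ =
    sg-resp (solve (u ∷ v ∷ [])
                   ((var 0 ⁻¹ ⊕ var 1 ⁻¹ ⊕ var 0 ⊕ var 1) ⁻¹)
                   (var 1 ⁻¹ ⊕ var 0 ⁻¹ ⊕ var 1 ⊕ var 0) refl)
            (sg-inv c∈)

  commutator-^ⁿ : ∀ u {v} → Normalizes v → Sub (commutator u v) → ∀ n → Sub (commutator u (v ^ⁿ n))
  commutator-^ⁿ u nv c∈ zero =
    sg-resp (solve (u ∷ []) ε (var 0 ⁻¹ ⊕ ε ⊕ var 0 ⊕ ε) refl) sg-one
  commutator-^ⁿ u {v} nv c∈ (suc n) =
    sg-resp (solve (u ∷ v ∷ v ^ⁿ n ∷ [])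
                   ((var 0 ⁻¹ ⊕ var 2 ⁻¹ ⊕ var 0 ⊕ var 2) ⊕ var 2 ⁻¹ ⊕ (var 0 ⁻¹ ⊕ var 1 ⁻¹ ⊕ var 0 ⊕ var 1) ⊕ var 2)
                   (var 0 ⁻¹ ⊕ (var 1 ⊕ var 2) ⁻¹ ⊕ var 0 ⊕ var 1 ⊕ var 2) refl)
            (sg-mul (commutator-^ⁿ u nv c∈ n) (^ᶜ-closed (normalizes-^ⁿ nv n) c∈))

  commutator-^ᶻ : ∀ u {v} → Normalizes v → Normalizes (inv v) →
    Sub (commutator u v) → Sub (commutator u (inv v)) → ∀ m → Sub (commutator u (v ^ᶻ m))
  commutator-^ᶻ u nv nv⁻¹ c∈ c⁻¹∈ (+ n) = commutator-^ⁿ u nv c∈ n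
  commutator-^ᶻ u nv nv⁻¹ c∈ c⁻¹∈ -[1+ n ] = commutator-^ⁿ u nv⁻¹ c⁻¹∈ (suc n)

-- A rewriting normal form for [12, 5]

open Congruence 12 5
open FreeGroupSolver 12 5
open Subgroup 12 5 stabGen renaming (Sub to ⟨stabGen⟩)

ca≈ac : c ∷ a ∷ [] ≈ a ∷ c ∷ []
ca≈ac = ≈sym (inverseˡ-unique (a ∷ c ∷ []) (a ∷ c ∷ []) (≈rel [] [] r-ac))

cbcbc≈bcbcb : c ∷ b ∷ c ∷ b ∷ c ∷ [] ≈ b ∷ c ∷ b ∷ c ∷ b ∷ []
cbcbc≈bcbcb = ≈sym (inverseˡ-unique (b ∷ c ∷ b ∷ c ∷ b ∷ []) (c ∷ b ∷ c ∷ b ∷ c ∷ []) (≈rel [] [] r-bc))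

[ba]⁶≈[ab]⁶ : (b ∷ a ∷ []) ^ⁿ 6 ≈ (a ∷ b ∷ []) ^ⁿ 6
[ba]⁶≈[ab]⁶ = ≈sym (inverseˡ-unique ((a ∷ b ∷ []) ^ⁿ 6) ((a ∷ b ∷ []) ^ⁿ 6) (≈rel [] [] r-ab))

cbcbac≈bcbcba : c ∷ b ∷ c ∷ b ∷ a ∷ c ∷ [] ≈ b ∷ c ∷ b ∷ c ∷ b ∷ a ∷ []
cbcbac≈bcbcba = begin
  c ∷ b ∷ c ∷ b ∷ a ∷ c ∷ []  ≈⟨ ≈-cong (c ∷ b ∷ c ∷ b ∷ []) [] (≈sym ca≈ac) ⟩
  c ∷ b ∷ c ∷ b ∷ c ∷ a ∷ []  ≈⟨ ≈-cong [] (a ∷ []) cbcbc≈bcbcb ⟩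
  b ∷ c ∷ b ∷ c ∷ b ∷ a ∷ []  ∎
  where open SetoidReasoning setoid

cbcbabcbcb≈bcbcbabcbc : c ∷ b ∷ c ∷ b ∷ a ∷ b ∷ c ∷ b ∷ c ∷ b ∷ [] ≈ b ∷ c ∷ b ∷ c ∷ b ∷ a ∷ b ∷ c ∷ b ∷ c ∷ []
cbcbabcbcb≈bcbcbabcbc = begin
  c ∷ b ∷ c ∷ b ∷ a ∷ b ∷ c ∷ b ∷ c ∷ b ∷ []  ≈⟨ ≈-cong (c ∷ b ∷ c ∷ b ∷ a ∷ []) [] (≈sym cbcbc≈bcbcb) ⟩
  c ∷ b ∷ c ∷ b ∷ a ∷ c ∷ b ∷ c ∷ b ∷ c ∷ []  ≈⟨ ≈-cong [] (b ∷ c ∷ b ∷ c ∷ []) cbcbac≈bcbcba ⟩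
  b ∷ c ∷ b ∷ c ∷ b ∷ a ∷ b ∷ c ∷ b ∷ c ∷ []  ∎
  where open SetoidReasoning setoid

cbcbabcbac[ba]⁵b≈bcbcbabcbac[ba]⁵ :
  (c ∷ b ∷ c ∷ b ∷ a ∷ b ∷ c ∷ b ∷ a ∷ c ∷ []) ++ (b ∷ a ∷ []) ^ⁿ 5 ++ b ∷ [] ≈
  (b ∷ c ∷ b ∷ c ∷ b ∷ a ∷ b ∷ c ∷ b ∷ a ∷ c ∷ []) ++ (b ∷ a ∷ []) ^ⁿ 5
cbcbabcbac[ba]⁵b≈bcbcbabcbac[ba]⁵ = begin
  (c ∷ b ∷ c ∷ b ∷ a ∷ b ∷ c ∷ b ∷ a ∷ c ∷ []) ++ (b ∷ a ∷ []) ^ⁿ 5 ++ b ∷ []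
    ≈⟨ ≈-cong (c ∷ b ∷ c ∷ b ∷ a ∷ b ∷ c ∷ b ∷ []) ((b ∷ a ∷ []) ^ⁿ 5 ++ b ∷ []) (≈sym ca≈ac) ⟩
  (c ∷ b ∷ c ∷ b ∷ a ∷ b ∷ c ∷ b ∷ c ∷ []) ++ (a ∷ b ∷ []) ^ⁿ 6
    ≈⟨ ≈-cong (c ∷ b ∷ c ∷ b ∷ a ∷ b ∷ c ∷ b ∷ c ∷ []) [] (≈sym [ba]⁶≈[ab]⁶) ⟩
  (c ∷ b ∷ c ∷ b ∷ a ∷ b ∷ c ∷ b ∷ c ∷ b ∷ []) ++ (a ∷ b ∷ []) ^ⁿ 5 ++ a ∷ []
    ≈⟨ ≈-cong [] ((a ∷ b ∷ []) ^ⁿ 5 ++ a ∷ []) cbcbabcbcb≈bcbcbabcbc ⟩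
  (b ∷ c ∷ b ∷ c ∷ b ∷ a ∷ b ∷ c ∷ b ∷ c ∷ []) ++ (a ∷ b ∷ []) ^ⁿ 5 ++ a ∷ []
    ≈⟨ ≈-cong (b ∷ c ∷ b ∷ c ∷ b ∷ a ∷ b ∷ c ∷ b ∷ []) ((b ∷ a ∷ []) ^ⁿ 5) ca≈ac ⟩
  (b ∷ c ∷ b ∷ c ∷ b ∷ a ∷ b ∷ c ∷ b ∷ a ∷ c ∷ []) ++ (b ∷ a ∷ []) ^ⁿ 5
    ∎
  where open SetoidReasoning setoid

reduction-rules : List (Word × Word)
reduction-rules =
  (a ∷ a ∷ [] , []) ∷
  (b ∷ b ∷ [] , []) ∷
  (c ∷ c ∷ [] , []) ∷
  (c ∷ a ∷ [] , a ∷ c ∷ []) ∷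
  (c ∷ b ∷ c ∷ b ∷ c ∷ [] , b ∷ c ∷ b ∷ c ∷ b ∷ []) ∷
  (c ∷ b ∷ c ∷ b ∷ a ∷ c ∷ [] , b ∷ c ∷ b ∷ c ∷ b ∷ a ∷ []) ∷
  (c ∷ b ∷ c ∷ b ∷ a ∷ b ∷ c ∷ b ∷ c ∷ b ∷ [] , b ∷ c ∷ b ∷ c ∷ b ∷ a ∷ b ∷ c ∷ b ∷ c ∷ []) ∷
  ((b ∷ a ∷ []) ^ⁿ 6 , (a ∷ b ∷ []) ^ⁿ 6) ∷
  ((c ∷ b ∷ c ∷ b ∷ a ∷ b ∷ c ∷ b ∷ a ∷ c ∷ []) ++ (b ∷ a ∷ []) ^ⁿ 5 ++ b ∷ [] ,
   (b ∷ c ∷ b ∷ c ∷ b ∷ a ∷ b ∷ c ∷ b ∷ a ∷ c ∷ []) ++ (b ∷ a ∷ []) ^ⁿ 5) ∷ []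

reduction-rules-sound : All (uncurry _≈_) reduction-rules
reduction-rules-sound =
  generator-involutive a ∷ generator-involutive b ∷ generator-involutive c ∷ ca≈ac ∷ cbcbc≈bcbcb ∷
  cbcbac≈bcbcba ∷ cbcbabcbcb≈bcbcbabcbc ∷ [ba]⁶≈[ab]⁶ ∷ cbcbabcbac[ba]⁵b≈bcbcbabcbac[ba]⁵ ∷ []

strip-prefix : Word → Word → Maybe Word
strip-prefix [] w = just w
strip-prefix (x ∷ l) [] = nothing
strip-prefix (x ∷ l) (y ∷ w) with x Fin.≟ y
... | yes _ = strip-prefix l w
... | no _ = nothing

strip-prefix-sound : ∀ l w {w′} → strip-prefix l w ≡ just w′ → w ≡ l ++ w′
strip-prefix-sound [] w refl = refl
strip-prefix-sound (x ∷ l) (y ∷ w) eq with x Fin.≟ y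
... | yes refl = cong (x ∷_) (strip-prefix-sound l w eq)

match-rule : List (Word × Word) → Word → Maybe (Word × Word)
match-rule [] st = nothing
match-rule ((l , r) ∷ rules) st with strip-prefix (reverse l) st
... | just s = just (s , r)
... | nothing = match-rule rules st

match-rule-sound : ∀ rules → All (uncurry _≈_) rules → ∀ st {s r} → match-rule rules st ≡ just (s , r) →
  Σ[ l ∈ Word ] st ≡ reverse l ++ s × l ≈ r
match-rule-sound ((l , r) ∷ rules) (l≈r ∷ sound) st eq with strip-prefix (reverse l) st in strip≡
match-rule-sound ((l , r) ∷ rules) (l≈r ∷ sound) st refl | just s =
  l , strip-prefix-sound (reverse l) st strip≡ , l≈r
match-rule-sound ((l , r) ∷ rules) (l≈r ∷ sound) st eq | nothing = match-rule-sound rules sound st eq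

unfold-reverse-++ : ∀ x (st w : Word) → reverse (x ∷ st) ++ w ≡ reverse st ++ x ∷ w
unfold-reverse-++ x st w = trans (cong (_++ w) (unfold-reverse x st)) (++-assoc (reverse st) [ x ] w)

reverse-reverse-++ : ∀ (l s : Word) → reverse (reverse l ++ s) ≡ reverse s ++ l
reverse-reverse-++ l s = trans (reverse-++ (reverse l) s) (cong (reverse s ++_) (reverse-involutive l))

-- reduce fuel st w keeps the processed prefix reversed in st, so a rule fires as soon as the
-- reversal of its left-hand side is a prefix of st.
reduce : ℕ → Word → Word → Word
reduce zero st w = reverse st ++ w
reduce (suc n) st [] = reverse st
reduce (suc n) st (x ∷ w) with match-rule reduction-rules (x ∷ st)
... | just (s , r) = reduce n s (r ++ w)
... | nothing = reduce n (x ∷ st) w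

reduce-sound : ∀ n st w → reduce n st w ≈ reverse st ++ w
reduce-sound zero st w = ≈refl
reduce-sound (suc n) st [] = ≈-reflexive (sym (++-identityʳ (reverse st)))
reduce-sound (suc n) st (x ∷ w) with match-rule reduction-rules (x ∷ st) in match≡
... | nothing = ≈trans (reduce-sound n (x ∷ st) w) (≈-reflexive (unfold-reverse-++ x st w))
... | just (s , r) with match-rule-sound reduction-rules reduction-rules-sound (x ∷ st) match≡
...   | l , x∷st≡ , l≈r = begin
  reduce n s (r ++ w)              ≈⟨ reduce-sound n s (r ++ w) ⟩
  reverse s ++ r ++ w              ≈⟨ ≈-congˡ (reverse s) (≈-congʳ w (≈sym l≈r)) ⟩
  reverse s ++ l ++ w              ≡⟨ ++-assoc (reverse s) l w ⟨
  (reverse s ++ l) ++ w            ≡⟨ cong (_++ w) (reverse-reverse-++ l s) ⟨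
  reverse (reverse l ++ s) ++ w    ≡⟨ cong (λ v → reverse v ++ w) x∷st≡ ⟨
  reverse (x ∷ st) ++ w            ≡⟨ unfold-reverse-++ x st w ⟩
  reverse st ++ x ∷ w              ∎
  where open SetoidReasoning setoid

normal-form : Word → Word
normal-form = reduce 1000000 []

normal-form-sound : ∀ w → normal-form w ≈ w
normal-form-sound = reduce-sound 1000000 []

infix 8 _⁺ _⁻
data GeneratorLetter : Set where
  _⁺ _⁻ : Fin 6 × ℤ × ℤ → GeneratorLetter

Certificate : Set
Certificate = List GeneratorLetter

certificate-word : Certificate → Word
certificate-word [] = []
certificate-word (x ⁺ ∷ cs) = stabGen x ++ certificate-word cs
certificate-word (x ⁻ ∷ cs) = inv (stabGen x) ++ certificate-word cs

certificate-word-∈ : ∀ cs → ⟨stabGen⟩ (certificate-word cs)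
certificate-word-∈ [] = sg-one
certificate-word-∈ (x ⁺ ∷ cs) = sg-mul (sg-gen x) (certificate-word-∈ cs)
certificate-word-∈ (x ⁻ ∷ cs) = sg-mul (sg-inv (sg-gen x)) (certificate-word-∈ cs)

certify : ∀ w cs → normal-form w ≡ normal-form (certificate-word cs) → ⟨stabGen⟩ w
certify w cs nf≡ =
  sg-resp (≈trans (≈sym (normal-form-sound (certificate-word cs)))
                  (≈trans (≈-reflexive (sym nf≡)) (normal-form-sound w)))
          (certificate-word-∈ cs)

commutator-β-γ : ⟨stabGen⟩ (commutator (β ^ᶻ 1ℤ) γ)
commutator-β-γ = certify _
  ((# 4 , + 1 , + 0) ⁻ ∷ (# 0 , + 1 , + 0) ⁻ ∷ (# 3 , + 0 , + 0) ⁺ ∷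
   (# 5 , + 0 , + 1) ⁻ ∷ (# 1 , + 0 , + 1) ⁺ ∷ (# 2 , + 0 , + 1) ⁺ ∷ []) refl

commutator-β-γ⁻¹ : ⟨stabGen⟩ (commutator (β ^ᶻ 1ℤ) (inv γ))
commutator-β-γ⁻¹ = certify _
  ((# 2 , + 0 , + 0) ⁻ ∷ (# 1 , + 0 , + 0) ⁻ ∷ (# 5 , + 0 , + 0) ⁺ ∷
   (# 3 , + 0 , -1ℤ) ⁻ ∷ (# 0 , + 1 , -1ℤ) ⁺ ∷ (# 4 , + 1 , -1ℤ) ⁺ ∷ []) refl

commutator-β⁻¹-γ : ⟨stabGen⟩ (commutator (β ^ᶻ -1ℤ) γ)
commutator-β⁻¹-γ = certify _
  ((# 3 , -1ℤ , + 0) ⁻ ∷ (# 0 , + 0 , + 0) ⁺ ∷ (# 4 , + 0 , + 0) ⁺ ∷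
   (# 2 , -1ℤ , + 1) ⁻ ∷ (# 1 , -1ℤ , + 1) ⁻ ∷ (# 5 , -1ℤ , + 1) ⁺ ∷ []) refl

commutator-β⁻¹-γ⁻¹ : ⟨stabGen⟩ (commutator (β ^ᶻ -1ℤ) (inv γ))
commutator-β⁻¹-γ⁻¹ = certify _
  ((# 5 , -1ℤ , + 0) ⁻ ∷ (# 1 , -1ℤ , + 0) ⁺ ∷ (# 2 , -1ℤ , + 0) ⁺ ∷
   (# 4 , + 0 , -1ℤ) ⁻ ∷ (# 0 , + 0 , -1ℤ) ⁻ ∷ (# 3 , -1ℤ , -1ℤ) ⁺ ∷ []) refl

-- Conjugation by the lattice words β and γ

βγ : ℤ → ℤ → Word
βγ J K = β ^ᶻ J ++ γ ^ᶻ K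

normalizes-γ^ : ∀ m → Normalizes (γ ^ᶻ m)
normalizes-γ^ m = normalizes-generators λ { (i , J , K) → sg-resp (shift i J K) (sg-gen (i , J , K + m)) }
  where
  shift : ∀ i J K → α i ^ᶜ βγ J (K + m) ≈ (α i ^ᶜ βγ J K) ^ᶜ (γ ^ᶻ m)
  shift i J K = ≈trans (^ᶜ-congʳ (α i) (≈-congˡ (β ^ᶻ J) (^ᶻ-+ γ K m)))
    (solve (α i ∷ β ^ᶻ J ∷ γ ^ᶻ K ∷ γ ^ᶻ m ∷ [])
           ((var 1 ⊕ var 2 ⊕ var 3) ⁻¹ ⊕ var 0 ⊕ var 1 ⊕ var 2 ⊕ var 3)
           (var 3 ⁻¹ ⊕ ((var 1 ⊕ var 2) ⁻¹ ⊕ var 0 ⊕ var 1 ⊕ var 2) ⊕ var 3) refl)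

normalizes-γ : Normalizes γ
normalizes-γ = subst Normalizes (++-identityʳ γ) (normalizes-γ^ 1ℤ)

normalizes-γ⁻¹ : Normalizes (inv γ)
normalizes-γ⁻¹ = subst Normalizes (++-identityʳ (inv γ)) (normalizes-γ^ -1ℤ)

commutator-γ^-β : ∀ K → ⟨stabGen⟩ (commutator (γ ^ᶻ K) (β ^ᶻ 1ℤ))
commutator-γ^-β K = commutator-swap (β ^ᶻ 1ℤ) (γ ^ᶻ K)
  (commutator-^ᶻ (β ^ᶻ 1ℤ) normalizes-γ normalizes-γ⁻¹ commutator-β-γ commutator-β-γ⁻¹ K)

commutator-γ^-β⁻¹ : ∀ K → ⟨stabGen⟩ (commutator (γ ^ᶻ K) (β ^ᶻ -1ℤ))
commutator-γ^-β⁻¹ K = commutator-swap (β ^ᶻ -1ℤ) (γ ^ᶻ K)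
  (commutator-^ᶻ (β ^ᶻ -1ℤ) normalizes-γ normalizes-γ⁻¹ commutator-β⁻¹-γ commutator-β⁻¹-γ⁻¹ K)

-- Conjugating by β^m moves every γ^K past β^m at the cost of the commutator [γ^K, β^m].
normalizes-β^ : ∀ m → (∀ K → ⟨stabGen⟩ (commutator (γ ^ᶻ K) (β ^ᶻ m))) → Normalizes (β ^ᶻ m)
normalizes-β^ m commutator-∈ = normalizes-generators λ { (i , J , K) →
  sg-resp (shift i J K) (Sub-^ᶜ (commutator-∈ K) (sg-gen (i , J + m , K))) }
  where
  shift : ∀ i J K → (α i ^ᶜ βγ (J + m) K) ^ᶜ commutator (γ ^ᶻ K) (β ^ᶻ m) ≈ (α i ^ᶜ βγ J K) ^ᶜ (β ^ᶻ m)
  shift i J K = ≈trans (^ᶜ-congˡ (commutator (γ ^ᶻ K) (β ^ᶻ m))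
                                 (^ᶜ-congʳ (α i) (≈-congʳ (γ ^ᶻ K) (^ᶻ-+ β J m))))
    (solve (α i ∷ β ^ᶻ J ∷ β ^ᶻ m ∷ γ ^ᶻ K ∷ [])
           (C ⁻¹ ⊕ (((var 1 ⊕ var 2) ⊕ var 3) ⁻¹ ⊕ var 0 ⊕ (var 1 ⊕ var 2) ⊕ var 3) ⊕ C)
           (var 2 ⁻¹ ⊕ ((var 1 ⊕ var 3) ⁻¹ ⊕ var 0 ⊕ var 1 ⊕ var 3) ⊕ var 2) refl)
    where
    C : Expr
    C = var 3 ⁻¹ ⊕ var 2 ⁻¹ ⊕ var 3 ⊕ var 2

normalizes-β : Normalizes β
normalizes-β = subst Normalizes (++-identityʳ β) (normalizes-β^ 1ℤ commutator-γ^-β)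

normalizes-β⁻¹ : Normalizes (inv β)
normalizes-β⁻¹ = subst Normalizes (++-identityʳ (inv β)) (normalizes-β^ -1ℤ commutator-γ^-β⁻¹)

normalizes-βγ : ∀ J K → Normalizes (βγ J K)
normalizes-βγ J K = normalizes-++ (normalizes-^ᶻ normalizes-β normalizes-β⁻¹ J) (normalizes-γ^ K)

commutator-β^-γ^ : ∀ J K → ⟨stabGen⟩ (commutator (β ^ᶻ J) (γ ^ᶻ K))
commutator-β^-γ^ J K = commutator-swap (γ ^ᶻ K) (β ^ᶻ J)
  (commutator-^ᶻ (γ ^ᶻ K) normalizes-β normalizes-β⁻¹
    (subst (λ v → ⟨stabGen⟩ (commutator (γ ^ᶻ K) v)) (++-identityʳ β) (commutator-γ^-β K))
    (subst (λ v → ⟨stabGen⟩ (commutator (γ ^ᶻ K) v)) (++-identityʳ (inv β)) (commutator-γ^-β⁻¹ K)) J)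

schreier-step : ∀ X m n → ⟨stabGen⟩ (X ++ β ^ᶻ m ++ γ ^ᶻ n) →
  ∀ J K → ⟨stabGen⟩ (inv (βγ J K) ++ X ++ βγ (m + J) (n + K))
schreier-step X m n X∈ J K =
  sg-resp (≈sym regroup)
    (sg-mul (^ᶜ-closed (normalizes-βγ J K) X∈) (^ᶜ-closed (normalizes-γ^ K) (commutator-β^-γ^ J n)))
  where
  regroup : inv (βγ J K) ++ X ++ βγ (m + J) (n + K) ≈
            (X ++ β ^ᶻ m ++ γ ^ᶻ n) ^ᶜ βγ J K ++ commutator (β ^ᶻ J) (γ ^ᶻ n) ^ᶜ (γ ^ᶻ K)
  regroup = ≈trans (≈-congˡ (inv (βγ J K)) (≈-congˡ X (≈-++ (^ᶻ-+ β m J) (^ᶻ-+ γ n K))))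
    (solve (X ∷ β ^ᶻ m ∷ γ ^ᶻ n ∷ β ^ᶻ J ∷ γ ^ᶻ K ∷ [])
           ((var 3 ⊕ var 4) ⁻¹ ⊕ var 0 ⊕ (var 1 ⊕ var 3) ⊕ (var 2 ⊕ var 4))
           (((var 3 ⊕ var 4) ⁻¹ ⊕ (var 0 ⊕ var 1 ⊕ var 2) ⊕ var 3 ⊕ var 4)
             ⊕ var 4 ⁻¹ ⊕ (var 3 ⁻¹ ⊕ var 2 ⁻¹ ⊕ var 3 ⊕ var 2) ⊕ var 4) refl)

-- The flag action

allFlagIx : {P : FlagIx → Set} →
  P f0 → P f1 → P f2 → P f3 → P f4 → P f5 → P f6 → P f7 →
  P f8 → P f9 → P f10 → P f11 → P f12 → P f13 → P f14 → P f15 →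
  P f16 → P f17 → P f18 → P f19 → P f20 → P f21 → P f22 → P f23 →
  P f24 → P f25 → P f26 → P f27 → P f28 → P f29 → P f30 → P f31 →
  P f32 → P f33 → P f34 → P f35 → P f36 → P f37 → P f38 → P f39 →
  ∀ k → P k
allFlagIx p _ _ _ _ _ _ _ _ _ _ _ _ _ _ _ _ _ _ _ _ _ _ _ _ _ _ _ _ _ _ _ _ _ _ _ _ _ _ _ f0 = p
allFlagIx _ p _ _ _ _ _ _ _ _ _ _ _ _ _ _ _ _ _ _ _ _ _ _ _ _ _ _ _ _ _ _ _ _ _ _ _ _ _ _ f1 = p
allFlagIx _ _ p _ _ _ _ _ _ _ _ _ _ _ _ _ _ _ _ _ _ _ _ _ _ _ _ _ _ _ _ _ _ _ _ _ _ _ _ _ f2 = p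
allFlagIx _ _ _ p _ _ _ _ _ _ _ _ _ _ _ _ _ _ _ _ _ _ _ _ _ _ _ _ _ _ _ _ _ _ _ _ _ _ _ _ f3 = p
allFlagIx _ _ _ _ p _ _ _ _ _ _ _ _ _ _ _ _ _ _ _ _ _ _ _ _ _ _ _ _ _ _ _ _ _ _ _ _ _ _ _ f4 = p
allFlagIx _ _ _ _ _ p _ _ _ _ _ _ _ _ _ _ _ _ _ _ _ _ _ _ _ _ _ _ _ _ _ _ _ _ _ _ _ _ _ _ f5 = p
allFlagIx _ _ _ _ _ _ p _ _ _ _ _ _ _ _ _ _ _ _ _ _ _ _ _ _ _ _ _ _ _ _ _ _ _ _ _ _ _ _ _ f6 = p
allFlagIx _ _ _ _ _ _ _ p _ _ _ _ _ _ _ _ _ _ _ _ _ _ _ _ _ _ _ _ _ _ _ _ _ _ _ _ _ _ _ _ f7 = p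
allFlagIx _ _ _ _ _ _ _ _ p _ _ _ _ _ _ _ _ _ _ _ _ _ _ _ _ _ _ _ _ _ _ _ _ _ _ _ _ _ _ _ f8 = p
allFlagIx _ _ _ _ _ _ _ _ _ p _ _ _ _ _ _ _ _ _ _ _ _ _ _ _ _ _ _ _ _ _ _ _ _ _ _ _ _ _ _ f9 = p
allFlagIx _ _ _ _ _ _ _ _ _ _ p _ _ _ _ _ _ _ _ _ _ _ _ _ _ _ _ _ _ _ _ _ _ _ _ _ _ _ _ _ f10 = p
allFlagIx _ _ _ _ _ _ _ _ _ _ _ p _ _ _ _ _ _ _ _ _ _ _ _ _ _ _ _ _ _ _ _ _ _ _ _ _ _ _ _ f11 = p
allFlagIx _ _ _ _ _ _ _ _ _ _ _ _ p _ _ _ _ _ _ _ _ _ _ _ _ _ _ _ _ _ _ _ _ _ _ _ _ _ _ _ f12 = p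
allFlagIx _ _ _ _ _ _ _ _ _ _ _ _ _ p _ _ _ _ _ _ _ _ _ _ _ _ _ _ _ _ _ _ _ _ _ _ _ _ _ _ f13 = p
allFlagIx _ _ _ _ _ _ _ _ _ _ _ _ _ _ p _ _ _ _ _ _ _ _ _ _ _ _ _ _ _ _ _ _ _ _ _ _ _ _ _ f14 = p
allFlagIx _ _ _ _ _ _ _ _ _ _ _ _ _ _ _ p _ _ _ _ _ _ _ _ _ _ _ _ _ _ _ _ _ _ _ _ _ _ _ _ f15 = p
allFlagIx _ _ _ _ _ _ _ _ _ _ _ _ _ _ _ _ p _ _ _ _ _ _ _ _ _ _ _ _ _ _ _ _ _ _ _ _ _ _ _ f16 = p
allFlagIx _ _ _ _ _ _ _ _ _ _ _ _ _ _ _ _ _ p _ _ _ _ _ _ _ _ _ _ _ _ _ _ _ _ _ _ _ _ _ _ f17 = p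
allFlagIx _ _ _ _ _ _ _ _ _ _ _ _ _ _ _ _ _ _ p _ _ _ _ _ _ _ _ _ _ _ _ _ _ _ _ _ _ _ _ _ f18 = p
allFlagIx _ _ _ _ _ _ _ _ _ _ _ _ _ _ _ _ _ _ _ p _ _ _ _ _ _ _ _ _ _ _ _ _ _ _ _ _ _ _ _ f19 = p
allFlagIx _ _ _ _ _ _ _ _ _ _ _ _ _ _ _ _ _ _ _ _ p _ _ _ _ _ _ _ _ _ _ _ _ _ _ _ _ _ _ _ f20 = p
allFlagIx _ _ _ _ _ _ _ _ _ _ _ _ _ _ _ _ _ _ _ _ _ p _ _ _ _ _ _ _ _ _ _ _ _ _ _ _ _ _ _ f21 = p
allFlagIx _ _ _ _ _ _ _ _ _ _ _ _ _ _ _ _ _ _ _ _ _ _ p _ _ _ _ _ _ _ _ _ _ _ _ _ _ _ _ _ f22 = p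
allFlagIx _ _ _ _ _ _ _ _ _ _ _ _ _ _ _ _ _ _ _ _ _ _ _ p _ _ _ _ _ _ _ _ _ _ _ _ _ _ _ _ f23 = p
allFlagIx _ _ _ _ _ _ _ _ _ _ _ _ _ _ _ _ _ _ _ _ _ _ _ _ p _ _ _ _ _ _ _ _ _ _ _ _ _ _ _ f24 = p
allFlagIx _ _ _ _ _ _ _ _ _ _ _ _ _ _ _ _ _ _ _ _ _ _ _ _ _ p _ _ _ _ _ _ _ _ _ _ _ _ _ _ f25 = p
allFlagIx _ _ _ _ _ _ _ _ _ _ _ _ _ _ _ _ _ _ _ _ _ _ _ _ _ _ p _ _ _ _ _ _ _ _ _ _ _ _ _ f26 = p
allFlagIx _ _ _ _ _ _ _ _ _ _ _ _ _ _ _ _ _ _ _ _ _ _ _ _ _ _ _ p _ _ _ _ _ _ _ _ _ _ _ _ f27 = p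
allFlagIx _ _ _ _ _ _ _ _ _ _ _ _ _ _ _ _ _ _ _ _ _ _ _ _ _ _ _ _ p _ _ _ _ _ _ _ _ _ _ _ f28 = p
allFlagIx _ _ _ _ _ _ _ _ _ _ _ _ _ _ _ _ _ _ _ _ _ _ _ _ _ _ _ _ _ p _ _ _ _ _ _ _ _ _ _ f29 = p
allFlagIx _ _ _ _ _ _ _ _ _ _ _ _ _ _ _ _ _ _ _ _ _ _ _ _ _ _ _ _ _ _ p _ _ _ _ _ _ _ _ _ f30 = p
allFlagIx _ _ _ _ _ _ _ _ _ _ _ _ _ _ _ _ _ _ _ _ _ _ _ _ _ _ _ _ _ _ _ p _ _ _ _ _ _ _ _ f31 = p
allFlagIx _ _ _ _ _ _ _ _ _ _ _ _ _ _ _ _ _ _ _ _ _ _ _ _ _ _ _ _ _ _ _ _ p _ _ _ _ _ _ _ f32 = p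
allFlagIx _ _ _ _ _ _ _ _ _ _ _ _ _ _ _ _ _ _ _ _ _ _ _ _ _ _ _ _ _ _ _ _ _ p _ _ _ _ _ _ f33 = p
allFlagIx _ _ _ _ _ _ _ _ _ _ _ _ _ _ _ _ _ _ _ _ _ _ _ _ _ _ _ _ _ _ _ _ _ _ p _ _ _ _ _ f34 = p
allFlagIx _ _ _ _ _ _ _ _ _ _ _ _ _ _ _ _ _ _ _ _ _ _ _ _ _ _ _ _ _ _ _ _ _ _ _ p _ _ _ _ f35 = p
allFlagIx _ _ _ _ _ _ _ _ _ _ _ _ _ _ _ _ _ _ _ _ _ _ _ _ _ _ _ _ _ _ _ _ _ _ _ _ p _ _ _ f36 = p
allFlagIx _ _ _ _ _ _ _ _ _ _ _ _ _ _ _ _ _ _ _ _ _ _ _ _ _ _ _ _ _ _ _ _ _ _ _ _ _ p _ _ f37 = p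
allFlagIx _ _ _ _ _ _ _ _ _ _ _ _ _ _ _ _ _ _ _ _ _ _ _ _ _ _ _ _ _ _ _ _ _ _ _ _ _ _ p _ f38 = p
allFlagIx _ _ _ _ _ _ _ _ _ _ _ _ _ _ _ _ _ _ _ _ _ _ _ _ _ _ _ _ _ _ _ _ _ _ _ _ _ _ _ p f39 = p

origin : FlagIx → Flag
origin k = + 0 , + 0 , k

fundamental : Flag → FlagIx
fundamental (_ , _ , k) = k

·-++ : ∀ Ψ u v → Ψ · (u ++ v) ≡ (Ψ · u) · v
·-++ Ψ [] v = refl
·-++ Ψ (i ∷ u) v = ·-++ (adjacent i Ψ) u v

translate-translate : ∀ {A : Set} x y x′ y′ (D : Displaced A) →
  translate x y (translate x′ y′ D) ≡ translate (x + x′) (y + y′) D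
translate-translate x y x′ y′ (p , q , k) =
  cong₂ (λ p′ q′ → p′ , q′ , k) (sym (ℤ.+-assoc x x′ p)) (sym (ℤ.+-assoc y y′ q))

translate-origin : ∀ x y k → translate x y (origin k) ≡ (x , y , k)
translate-origin x y k = cong₂ (λ p q → p , q , k) (ℤ.+-identityʳ x) (ℤ.+-identityʳ y)

adjacent-translate : ∀ i x y Ψ → adjacent i (translate x y Ψ) ≡ translate x y (adjacent i Ψ)
adjacent-translate i x y (x′ , y′ , k) = sym (translate-translate x y x′ y′ (adjTable i k))

·-translate : ∀ x y Ψ w → translate x y Ψ · w ≡ translate x y (Ψ · w)
·-translate x y Ψ [] = refl
·-translate x y Ψ (i ∷ w) = trans (cong (_· w) (adjacent-translate i x y Ψ)) (·-translate x y (adjacent i Ψ) w)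

stabilizer-translate : ∀ x y Ψ w → InStab Ψ w → InStab (translate x y Ψ) w
stabilizer-translate x y Ψ w Ψw≡Ψ = trans (·-translate x y Ψ w) (cong (translate x y) Ψw≡Ψ)

stabilizer-fundamental : ∀ {Ψ Ψ′} w → fundamental Ψ ≡ fundamental Ψ′ → InStab Ψ w → InStab Ψ′ w
stabilizer-fundamental {x , y , k} {x′ , y′ , .k} w refl Ψw≡Ψ =
  subst (λ Ψ → InStab Ψ w) moved (stabilizer-translate (x′ - x) (y′ - y) (x , y , k) w Ψw≡Ψ)
  where
  moved : translate (x′ - x) (y′ - y) (x , y , k) ≡ (x′ , y′ , k)
  moved = cong₂ (λ p q → p , q , k) (m-n+n≡m x′ x) (m-n+n≡m y′ y)
    where
    m-n+n≡m : ∀ m n → (m - n) + n ≡ m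
    m-n+n≡m = solve-∀

relator-fixes-origin : ∀ {r} → Relator 12 5 r → ∀ k → origin k · r ≡ origin k
relator-fixes-origin r-a = allFlagIx refl refl refl refl refl refl refl refl refl refl refl refl refl refl refl refl refl refl refl refl refl refl refl refl refl refl refl refl refl refl refl refl refl refl refl refl refl refl refl refl
relator-fixes-origin r-b = allFlagIx refl refl refl refl refl refl refl refl refl refl refl refl refl refl refl refl refl refl refl refl refl refl refl refl refl refl refl refl refl refl refl refl refl refl refl refl refl refl refl refl
relator-fixes-origin r-c = allFlagIx refl refl refl refl refl refl refl refl refl refl refl refl refl refl refl refl refl refl refl refl refl refl refl refl refl refl refl refl refl refl refl refl refl refl refl refl refl refl refl refl
relator-fixes-origin r-ac = allFlagIx refl refl refl refl refl refl refl refl refl refl refl refl refl refl refl refl refl refl refl refl refl refl refl refl refl refl refl refl refl refl refl refl refl refl refl refl refl refl refl refl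
relator-fixes-origin r-ab = allFlagIx refl refl refl refl refl refl refl refl refl refl refl refl refl refl refl refl refl refl refl refl refl refl refl refl refl refl refl refl refl refl refl refl refl refl refl refl refl refl refl refl
relator-fixes-origin r-bc = allFlagIx refl refl refl refl refl refl refl refl refl refl refl refl refl refl refl refl refl refl refl refl refl refl refl refl refl refl refl refl refl refl refl refl refl refl refl refl refl refl refl refl

relator-fixes : ∀ {r} → Relator 12 5 r → ∀ Ψ → Ψ · r ≡ Ψ
relator-fixes {r} rel (x , y , k) = stabilizer-fundamental r refl (relator-fixes-origin rel k)

·-cong : ∀ Ψ {u v} → u ≈ v → Ψ · u ≡ Ψ · v
·-cong Ψ ≈refl = refl
·-cong Ψ (≈sym u≈v) = sym (·-cong Ψ u≈v)
·-cong Ψ (≈trans u≈v v≈w) = trans (·-cong Ψ u≈v) (·-cong Ψ v≈w)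
·-cong Ψ (≈rel {r = r} u v rel) = begin
  Ψ · (u ++ r ++ v)    ≡⟨ ·-++ Ψ u (r ++ v) ⟩
  (Ψ · u) · (r ++ v)   ≡⟨ ·-++ (Ψ · u) r v ⟩
  ((Ψ · u) · r) · v    ≡⟨ cong (_· v) (relator-fixes rel (Ψ · u)) ⟩
  (Ψ · u) · v          ≡⟨ ·-++ Ψ u v ⟨
  Ψ · (u ++ v)         ∎
  where open ≡-Reasoning

⟨stabGen⟩⊆stabilizer : ∀ Φ → (∀ x → InStab Φ (stabGen x)) → ∀ {w} → ⟨stabGen⟩ w → InStab Φ w
⟨stabGen⟩⊆stabilizer Φ gen-fixes (sg-gen x) = gen-fixes x
⟨stabGen⟩⊆stabilizer Φ gen-fixes sg-one = refl
⟨stabGen⟩⊆stabilizer Φ gen-fixes (sg-mul {u} {v} u∈ v∈) = begin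
  Φ · (u ++ v)   ≡⟨ ·-++ Φ u v ⟩
  (Φ · u) · v    ≡⟨ cong (_· v) (⟨stabGen⟩⊆stabilizer Φ gen-fixes u∈) ⟩
  Φ · v          ≡⟨ ⟨stabGen⟩⊆stabilizer Φ gen-fixes v∈ ⟩
  Φ              ∎
  where open ≡-Reasoning
⟨stabGen⟩⊆stabilizer Φ gen-fixes (sg-inv {u} u∈) = begin
  Φ · inv u              ≡⟨ cong (_· inv u) (⟨stabGen⟩⊆stabilizer Φ gen-fixes u∈) ⟨
  (Φ · u) · inv u        ≡⟨ ·-++ Φ u (inv u) ⟨
  Φ · (u ++ inv u)       ≡⟨ ·-cong Φ (++-inverseʳ u) ⟩
  Φ                      ∎
  where open ≡-Reasoning
⟨stabGen⟩⊆stabilizer Φ gen-fixes (sg-resp u≈v u∈) =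
  trans (sym (·-cong Φ u≈v)) (⟨stabGen⟩⊆stabilizer Φ gen-fixes u∈)

-- The stabilizer of the base flag

base : Flag
base = origin f25

fundamental-· : ∀ x y k w → fundamental ((x , y , k) · w) ≡ fundamental (origin k · w)
fundamental-· x y k w =
  cong fundamental (trans (cong (_· w) (sym (translate-origin x y k))) (·-translate x y (origin k) w))

PreservesFundamental : FlagIx → Word → Set
PreservesFundamental k g = ∀ Ψ → fundamental Ψ ≡ k → fundamental (Ψ · g) ≡ k

preserves-fundamental : ∀ k g → fundamental (origin k · g) ≡ k → PreservesFundamental k g
preserves-fundamental k g origin-g (x , y , .k) refl = trans (fundamental-· x y k g) origin-g

preserves-++ : ∀ {k} u v → PreservesFundamental k u → PreservesFundamental k v → PreservesFundamental k (u ++ v)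
preserves-++ u v pu pv Ψ Ψ∈k = trans (cong fundamental (·-++ Ψ u v)) (pv (Ψ · u) (pu Ψ Ψ∈k))

preserves-^ⁿ : ∀ {k} g → PreservesFundamental k g → ∀ n → PreservesFundamental k (g ^ⁿ n)
preserves-^ⁿ g pg zero Ψ Ψ∈k = Ψ∈k
preserves-^ⁿ g pg (suc n) = preserves-++ g (g ^ⁿ n) pg (preserves-^ⁿ g pg n)

preserves-^ᶻ : ∀ {k} g → PreservesFundamental k g → PreservesFundamental k (inv g) →
  ∀ m → PreservesFundamental k (g ^ᶻ m)
preserves-^ᶻ g pg pg⁻¹ (+ n) = preserves-^ⁿ g pg n
preserves-^ᶻ g pg pg⁻¹ -[1+ n ] = preserves-^ⁿ (inv g) pg⁻¹ (suc n)

βγ⁻¹-preserves-base : ∀ J K → PreservesFundamental f25 (inv (βγ J K))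
βγ⁻¹-preserves-base J K =
  subst (PreservesFundamental f25) (sym inv-βγ)
    (preserves-++ (inv γ ^ᶻ K) (inv β ^ᶻ J)
      (preserves-^ᶻ (inv γ) (preserves-fundamental f25 (inv γ) refl) (preserves-fundamental f25 γ refl) K)
      (preserves-^ᶻ (inv β) (preserves-fundamental f25 (inv β) refl) (preserves-fundamental f25 β refl) J))
  where
  inv-βγ : inv (βγ J K) ≡ inv γ ^ᶻ K ++ inv β ^ᶻ J
  inv-βγ = trans (reverse-++ (β ^ᶻ J) (γ ^ᶻ K)) (cong₂ _++_ (inv-^ᶻ γ K) (inv-^ᶻ β J))

α-fixes-base : ∀ i → InStab base (α i)
α-fixes-base zero = refl
α-fixes-base (suc zero) = refl
α-fixes-base (suc (suc zero)) = refl
α-fixes-base (suc (suc (suc zero))) = refl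
α-fixes-base (suc (suc (suc (suc zero)))) = refl
α-fixes-base (suc (suc (suc (suc (suc zero))))) = refl

stabGen-fixes-base : ∀ x → InStab base (stabGen x)
stabGen-fixes-base (i , J , K) = begin
  base · (inv (βγ J K) ++ α i ++ βγ J K)  ≡⟨ ·-++ base (inv (βγ J K)) (α i ++ βγ J K) ⟩
  Ψ · (α i ++ βγ J K)                     ≡⟨ ·-++ Ψ (α i) (βγ J K) ⟩
  (Ψ · α i) · βγ J K                      ≡⟨ cong (_· βγ J K) Ψ-α≡Ψ ⟩
  Ψ · βγ J K                              ≡⟨ ·-++ base (inv (βγ J K)) (βγ J K) ⟨
  base · (inv (βγ J K) ++ βγ J K)         ≡⟨ ·-cong base (++-inverseˡ (βγ J K)) ⟩
  base                                    ∎
  where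
  open ≡-Reasoning
  Ψ = base · inv (βγ J K)
  Ψ-α≡Ψ : InStab Ψ (α i)
  Ψ-α≡Ψ = stabilizer-fundamental (α i) (sym (βγ⁻¹-preserves-base J K base refl)) (α-fixes-base i)

-- base · path k is the translate of the fundamental flag k by offset k.
path : FlagIx → Word
path f0 = c ∷ a ∷ b ∷ c ∷ a ∷ b ∷ a ∷ []
path f1 = c ∷ a ∷ b ∷ c ∷ a ∷ b ∷ []
path f2 = c ∷ a ∷ b ∷ c ∷ a ∷ []
path f3 = c ∷ a ∷ b ∷ c ∷ []
path f4 = c ∷ a ∷ b ∷ c ∷ b ∷ []
path f5 = c ∷ a ∷ b ∷ c ∷ b ∷ a ∷ []
path f6 = c ∷ b ∷ c ∷ b ∷ c ∷ []
path f7 = c ∷ b ∷ c ∷ b ∷ c ∷ a ∷ []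
path f8 = c ∷ b ∷ c ∷ b ∷ c ∷ a ∷ b ∷ []
path f9 = c ∷ b ∷ c ∷ b ∷ c ∷ a ∷ b ∷ a ∷ []
path f10 = c ∷ b ∷ c ∷ b ∷ c ∷ b ∷ a ∷ []
path f11 = c ∷ b ∷ c ∷ b ∷ c ∷ b ∷ []
path f12 = b ∷ c ∷ b ∷ []
path f13 = b ∷ c ∷ b ∷ a ∷ []
path f14 = b ∷ c ∷ a ∷ b ∷ a ∷ []
path f15 = b ∷ c ∷ a ∷ b ∷ []
path f16 = b ∷ c ∷ a ∷ []
path f17 = b ∷ c ∷ []
path f18 = c ∷ a ∷ b ∷ []
path f19 = c ∷ a ∷ b ∷ a ∷ []
path f20 = c ∷ b ∷ a ∷ []
path f21 = c ∷ b ∷ []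
path f22 = c ∷ []
path f23 = c ∷ a ∷ []
path f24 = a ∷ []
path f25 = []
path f26 = b ∷ []
path f27 = b ∷ a ∷ []
path f28 = b ∷ a ∷ b ∷ []
path f29 = a ∷ b ∷ a ∷ b ∷ []
path f30 = a ∷ b ∷ a ∷ []
path f31 = a ∷ b ∷ []
path f32 = c ∷ b ∷ c ∷ []
path f33 = c ∷ b ∷ c ∷ a ∷ []
path f34 = c ∷ b ∷ c ∷ a ∷ b ∷ []
path f35 = c ∷ b ∷ c ∷ a ∷ b ∷ a ∷ []
path f36 = c ∷ b ∷ c ∷ a ∷ b ∷ a ∷ b ∷ []
path f37 = c ∷ b ∷ c ∷ b ∷ a ∷ b ∷ []
path f38 = c ∷ b ∷ c ∷ b ∷ a ∷ []
path f39 = c ∷ b ∷ c ∷ b ∷ []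

offset : FlagIx → ℤ × ℤ
offset k = proj₁ (base · path k) , proj₁ (proj₂ (base · path k))

β-exponent γ-exponent : Flag → ℤ
β-exponent (x , y , k) = (proj₁ (offset k) - x) - (proj₂ (offset k) - y)
γ-exponent (x , y , k) = proj₂ (offset k) - y

transversal-at : ℤ → ℤ → FlagIx → Word
transversal-at J K k = inv (βγ J K) ++ path k

-- base · transversal Ψ ≡ Ψ, since β and γ translate the base flag by (1, 0) and (1, 1).
transversal : Flag → Word
transversal Ψ = transversal-at (β-exponent Ψ) (γ-exponent Ψ) (fundamental Ψ)

β-shift γ-shift : Fin 3 → FlagIx → ℤ
β-shift i k = β-exponent (adjTable i k) - β-exponent (origin k)
γ-shift i k = γ-exponent (adjTable i k) - γ-exponent (origin k)

β-exponent-adjacent : ∀ i x y k → β-exponent (adjacent i (x , y , k)) ≡ β-shift i k + β-exponent (x , y , k)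
β-exponent-adjacent i x y k with adjTable i k
... | p , q , k′ = linear (proj₁ (offset k)) (proj₂ (offset k)) (proj₁ (offset k′)) (proj₂ (offset k′)) x y p q
  where
  linear : ∀ o₁ o₂ o₁′ o₂′ x y p q →
    (o₁′ - (x + p)) - (o₂′ - (y + q)) ≡ (((o₁′ - p) - (o₂′ - q)) - ((o₁ - + 0) - (o₂ - + 0))) + ((o₁ - x) - (o₂ - y))
  linear = solve-∀

γ-exponent-adjacent : ∀ i x y k → γ-exponent (adjacent i (x , y , k)) ≡ γ-shift i k + γ-exponent (x , y , k)
γ-exponent-adjacent i x y k with adjTable i k
... | p , q , k′ = linear (proj₂ (offset k)) (proj₂ (offset k′)) y q
  where
  linear : ∀ o₂ o₂′ y q → o₂′ - (y + q) ≡ ((o₂′ - q) - (o₂ - + 0)) + (o₂ - y)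
  linear = solve-∀

-- The Schreier generators not listed are trivial in [12, 5].
schreier-certificate : Fin 3 → FlagIx → Certificate
schreier-certificate (suc zero) f0 = (# 5 , + 0 , + 0) ⁺ ∷ []
schreier-certificate (suc (suc zero)) f0 = (# 5 , + 0 , + 0) ⁺ ∷ (# 3 , + 0 , -1ℤ) ⁻ ∷ []
schreier-certificate (suc (suc zero)) f1 =
  (# 5 , + 0 , + 0) ⁺ ∷ (# 3 , + 0 , -1ℤ) ⁻ ∷ (# 0 , + 1 , -1ℤ) ⁺ ∷ []
schreier-certificate (suc zero) f5 = (# 5 , + 0 , + 0) ⁻ ∷ []
schreier-certificate (suc (suc zero)) f5 = (# 2 , -1ℤ , + 0) ⁻ ∷ []
schreier-certificate (suc zero) f9 = (# 3 , + 0 , + 0) ⁺ ∷ []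
schreier-certificate (suc zero) f10 = (# 3 , + 0 , + 0) ⁻ ∷ []
schreier-certificate (suc zero) f13 = (# 4 , + 0 , + 0) ⁻ ∷ []
schreier-certificate (suc zero) f14 = (# 4 , + 0 , + 0) ⁺ ∷ []
schreier-certificate (suc (suc zero)) f14 = (# 4 , + 0 , + 0) ⁺ ∷ (# 2 , -1ℤ , + 1) ⁻ ∷ []
schreier-certificate (suc (suc zero)) f15 = (# 4 , + 0 , + 0) ⁺ ∷ (# 2 , -1ℤ , + 1) ⁻ ∷ []
schreier-certificate (suc zero) f19 = (# 1 , + 0 , + 0) ⁺ ∷ []
schreier-certificate (suc zero) f20 = (# 1 , + 0 , + 0) ⁻ ∷ []
schreier-certificate zero f28 = (# 0 , + 0 , + 0) ⁻ ∷ []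
schreier-certificate (suc (suc zero)) f28 =
  (# 4 , + 0 , + 0) ⁺ ∷ (# 2 , -1ℤ , + 1) ⁻ ∷ (# 1 , -1ℤ , + 1) ⁻ ∷ []
schreier-certificate zero f29 = (# 0 , + 0 , + 0) ⁺ ∷ []
schreier-certificate (suc (suc zero)) f29 =
  (# 0 , + 0 , + 0) ⁺ ∷ (# 4 , + 0 , + 0) ⁺ ∷ (# 2 , -1ℤ , + 1) ⁻ ∷ (# 1 , -1ℤ , + 1) ⁻ ∷ []
schreier-certificate (suc (suc zero)) f34 =
  (# 1 , + 0 , + 0) ⁻ ∷ (# 5 , + 0 , + 0) ⁺ ∷ (# 3 , + 0 , -1ℤ) ⁻ ∷ (# 0 , + 1 , -1ℤ) ⁺ ∷ []
schreier-certificate (suc (suc zero)) f35 =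
  (# 1 , + 0 , + 0) ⁻ ∷ (# 5 , + 0 , + 0) ⁺ ∷ (# 3 , + 0 , -1ℤ) ⁻ ∷ (# 0 , + 1 , -1ℤ) ⁺ ∷ []
schreier-certificate zero f36 = (# 2 , + 0 , + 0) ⁺ ∷ []
schreier-certificate (suc (suc zero)) f36 = (# 2 , + 0 , + 0) ⁺ ∷ []
schreier-certificate zero f37 = (# 2 , + 0 , + 0) ⁻ ∷ []
schreier-certificate _ _ = []

schreier-word : Fin 3 → FlagIx → Word
schreier-word i k = path k ++ [ i ] ++ inv (path (fundamental (adjTable i k)))

schreier-generator-certified : ∀ i k → ⟨stabGen⟩ (schreier-word i k ++ β ^ᶻ β-shift i k ++ γ ^ᶻ γ-shift i k)
schreier-generator-certified i k = certify _ (schreier-certificate i k) (certified i k)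
  where
  certified : ∀ i k →
    normal-form (schreier-word i k ++ β ^ᶻ β-shift i k ++ γ ^ᶻ γ-shift i k)
      ≡ normal-form (certificate-word (schreier-certificate i k))
  certified zero = allFlagIx refl refl refl refl refl refl refl refl refl refl refl refl refl refl refl refl refl refl refl refl refl refl refl refl refl refl refl refl refl refl refl refl refl refl refl refl refl refl refl refl
  certified (suc zero) = allFlagIx refl refl refl refl refl refl refl refl refl refl refl refl refl refl refl refl refl refl refl refl refl refl refl refl refl refl refl refl refl refl refl refl refl refl refl refl refl refl refl refl
  certified (suc (suc zero)) = allFlagIx refl refl refl refl refl refl refl refl refl refl refl refl refl refl refl refl refl refl refl refl refl refl refl refl refl refl refl refl refl refl refl refl refl refl refl refl refl refl refl refl

schreier-generator : ∀ i Ψ → ⟨stabGen⟩ (transversal Ψ ++ [ i ] ++ inv (transversal (adjacent i Ψ)))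
schreier-generator i (x , y , k) =
  subst₂ (λ J′ K′ → ⟨stabGen⟩ (transversal-at J K k ++ [ i ] ++ inv (transversal-at J′ K′ k′)))
         (sym (β-exponent-adjacent i x y k)) (sym (γ-exponent-adjacent i x y k))
         (sg-resp regroup (schreier-step X (β-shift i k) (γ-shift i k) (schreier-generator-certified i k) J K))
  where
  J = β-exponent (x , y , k)
  K = γ-exponent (x , y , k)
  k′ = fundamental (adjTable i k)
  X = schreier-word i k
  βγ′ = βγ (β-shift i k + J) (γ-shift i k + K)
  regroup : inv (βγ J K) ++ X ++ βγ′ ≈ transversal-at J K k ++ [ i ] ++ inv (inv βγ′ ++ path k′)
  regroup = solve (βγ J K ∷ βγ′ ∷ path k ∷ path k′ ∷ [ i ] ∷ [])
                  (var 0 ⁻¹ ⊕ (var 2 ⊕ var 4 ⊕ var 3 ⁻¹) ⊕ var 1)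
                  ((var 0 ⁻¹ ⊕ var 2) ⊕ var 4 ⊕ (var 1 ⁻¹ ⊕ var 3) ⁻¹) refl

transversal-schreier : ∀ Ψ w → ⟨stabGen⟩ (transversal Ψ ++ w ++ inv (transversal (Ψ · w)))
transversal-schreier Ψ [] =
  sg-resp (≈sym (solve (transversal Ψ ∷ []) (var 0 ⊕ ε ⊕ var 0 ⁻¹) ε refl)) sg-one
transversal-schreier Ψ (i ∷ w) =
  sg-resp regroup (sg-mul (schreier-generator i Ψ) (transversal-schreier (adjacent i Ψ) w))
  where
  regroup : (transversal Ψ ++ [ i ] ++ inv (transversal (adjacent i Ψ))) ++
            (transversal (adjacent i Ψ) ++ w ++ inv (transversal (Ψ · (i ∷ w))))
            ≈ transversal Ψ ++ (i ∷ w) ++ inv (transversal (Ψ · (i ∷ w)))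
  regroup = solve (transversal Ψ ∷ transversal (adjacent i Ψ) ∷ transversal (Ψ · (i ∷ w)) ∷ [ i ] ∷ w ∷ [])
                  ((var 0 ⊕ var 3 ⊕ var 1 ⁻¹) ⊕ (var 1 ⊕ var 4 ⊕ var 2 ⁻¹))
                  (var 0 ⊕ (var 3 ⊕ var 4) ⊕ var 2 ⁻¹) refl

-- transversal base reduces to [].
stabilizer⊆⟨stabGen⟩ : ∀ {w} → InStab base w → ⟨stabGen⟩ w
stabilizer⊆⟨stabGen⟩ {w} base-w≡base =
  subst ⟨stabGen⟩ (++-identityʳ w)
    (subst (λ Ψ → ⟨stabGen⟩ (w ++ inv (transversal Ψ))) base-w≡base (transversal-schreier base w))

⟨stabGen⟩⊆stabilizer-base : ∀ {w} → ⟨stabGen⟩ w → InStab base w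
⟨stabGen⟩⊆stabilizer-base = ⟨stabGen⟩⊆stabilizer base stabGen-fixes-base

-- Symmetries of the tiling

record Symmetry : Set where
  field
    apply : Flag → Flag
    apply-adjacent : ∀ i Ψ → apply (adjacent i Ψ) ≡ adjacent i (apply Ψ)

  apply-· : ∀ Ψ w → apply (Ψ · w) ≡ apply Ψ · w
  apply-· Ψ [] = refl
  apply-· Ψ (i ∷ w) = trans (apply-· (adjacent i Ψ) w) (cong (_· w) (apply-adjacent i Ψ))

  stabilizer-apply : ∀ {Ψ w} → InStab Ψ w → InStab (apply Ψ) w
  stabilizer-apply {Ψ} {w} Ψw≡Ψ = trans (sym (apply-· Ψ w)) (cong apply Ψw≡Ψ)

open Symmetry

identity : Symmetry
identity = record { apply = λ Ψ → Ψ ; apply-adjacent = λ _ _ → refl }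

infixr 9 _∘ˢ_
_∘ˢ_ : Symmetry → Symmetry → Symmetry
σ ∘ˢ τ = record
  { apply = λ Ψ → apply σ (apply τ Ψ)
  ; apply-adjacent = λ i Ψ → trans (cong (apply σ) (apply-adjacent τ i Ψ)) (apply-adjacent σ i (apply τ Ψ))
  }

module LatticeSymmetry (m₁₁ m₁₂ m₂₁ m₂₂ : ℤ) (image : Flag) where

  linear₁ linear₂ : ℤ → ℤ → ℤ
  linear₁ x y = m₁₁ * x + m₁₂ * y
  linear₂ x y = m₂₁ * x + m₂₂ * y

  -- A symmetry commuting with the flag action is determined by the image of the base flag:
  -- the flag reached from the base along path k must go to image · path k.
  on-fundamental : FlagIx → Flag
  on-fundamental k = translate (- linear₁ (proj₁ (offset k)) (proj₂ (offset k)))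
                               (- linear₂ (proj₁ (offset k)) (proj₂ (offset k)))
                               (image · path k)

  map : Flag → Flag
  map (x , y , k) = translate (linear₁ x y) (linear₂ x y) (on-fundamental k)

  map-translate : ∀ x y D → map (translate x y D) ≡ translate (linear₁ x y) (linear₂ x y) (map D)
  map-translate x y (p , q , k) = begin
    translate (linear₁ (x + p) (y + q)) (linear₂ (x + p) (y + q)) (on-fundamental k)
      ≡⟨ cong₂ (λ u v → translate u v (on-fundamental k))
               (additive m₁₁ m₁₂ x y p q) (additive m₂₁ m₂₂ x y p q) ⟩
    translate (linear₁ x y + linear₁ p q) (linear₂ x y + linear₂ p q) (on-fundamental k)
      ≡⟨ translate-translate (linear₁ x y) (linear₂ x y) (linear₁ p q) (linear₂ p q) (on-fundamental k) ⟨
    translate (linear₁ x y) (linear₂ x y) (map (p , q , k))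
      ∎
    where
    open ≡-Reasoning
    additive : ∀ m n x y p q → m * (x + p) + n * (y + q) ≡ (m * x + n * y) + (m * p + n * q)
    additive = solve-∀

  symmetry : (∀ i k → map (adjTable i k) ≡ adjacent i (on-fundamental k)) → Symmetry
  symmetry compatible = record { apply = map ; apply-adjacent = map-adjacent }
    where
    map-adjacent : ∀ i Ψ → map (adjacent i Ψ) ≡ adjacent i (map Ψ)
    map-adjacent i (x , y , k) = begin
      map (translate x y (adjTable i k))                  ≡⟨ map-translate x y (adjTable i k) ⟩
      shift (map (adjTable i k))                          ≡⟨ cong shift (compatible i k) ⟩
      shift (adjacent i (on-fundamental k))               ≡⟨ adjacent-translate i (linear₁ x y) (linear₂ x y) _ ⟨
      adjacent i (map (x , y , k))                        ∎
      where
      open ≡-Reasoning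
      shift : Flag → Flag
      shift = translate (linear₁ x y) (linear₂ x y)

-- The quarter turn about the centre of the square t4.
ρ : Symmetry
ρ = symmetry compatible
  where
  open LatticeSymmetry (+ 0) (+ 1) -1ℤ (+ 0) (origin f31)
  compatible : ∀ i k → map (adjTable i k) ≡ adjacent i (on-fundamental k)
  compatible zero = allFlagIx refl refl refl refl refl refl refl refl refl refl refl refl refl refl refl refl refl refl refl refl refl refl refl refl refl refl refl refl refl refl refl refl refl refl refl refl refl refl refl refl
  compatible (suc zero) = allFlagIx refl refl refl refl refl refl refl refl refl refl refl refl refl refl refl refl refl refl refl refl refl refl refl refl refl refl refl refl refl refl refl refl refl refl refl refl refl refl refl refl
  compatible (suc (suc zero)) = allFlagIx refl refl refl refl refl refl refl refl refl refl refl refl refl refl refl refl refl refl refl refl refl refl refl refl refl refl refl refl refl refl refl refl refl refl refl refl refl refl refl refl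

-- An orientation-reversing symmetry exchanging the squares t4 and t5.
τ : Symmetry
τ = symmetry compatible
  where
  open LatticeSymmetry (+ 0) (+ 1) (+ 1) (+ 0) (-1ℤ , -1ℤ , f32)
  compatible : ∀ i k → map (adjTable i k) ≡ adjacent i (on-fundamental k)
  compatible zero = allFlagIx refl refl refl refl refl refl refl refl refl refl refl refl refl refl refl refl refl refl refl refl refl refl refl refl refl refl refl refl refl refl refl refl refl refl refl refl refl refl refl refl
  compatible (suc zero) = allFlagIx refl refl refl refl refl refl refl refl refl refl refl refl refl refl refl refl refl refl refl refl refl refl refl refl refl refl refl refl refl refl refl refl refl refl refl refl refl refl refl refl
  compatible (suc (suc zero)) = allFlagIx refl refl refl refl refl refl refl refl refl refl refl refl refl refl refl refl refl refl refl refl refl refl refl refl refl refl refl refl refl refl refl refl refl refl refl refl refl refl refl refl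

infix 4 _⇝_
_⇝_ : FlagIx → FlagIx → Set
k ⇝ k′ = Σ[ σ ∈ Symmetry ] fundamental (apply σ (origin k)) ≡ k′

stabilizer-⇝ : ∀ {k k′} w → k ⇝ k′ → InStab (origin k) w → InStab (origin k′) w
stabilizer-⇝ {k} w (σ , σk≡k′) stab = stabilizer-fundamental w σk≡k′ (stabilizer-apply σ {origin k} {w} stab)

square-flags-equivalent : ∀ {x y} k → IsSquareTile (tileOf (x , y , k)) →
  IsSquareTile (tileOf ((x , y , k) · cbc)) → (k ⇝ f25) × (f25 ⇝ k)
square-flags-equivalent f25 _ _ = (identity , refl) , (identity , refl)
square-flags-equivalent f27 _ _ = (ρ , refl) , (ρ ∘ˢ ρ ∘ˢ ρ , refl)
square-flags-equivalent f29 _ _ = (ρ ∘ˢ ρ , refl) , (ρ ∘ˢ ρ , refl)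
square-flags-equivalent f31 _ _ = (ρ ∘ˢ ρ ∘ˢ ρ , refl) , (ρ , refl)
square-flags-equivalent f32 _ _ = (τ , refl) , (τ , refl)
square-flags-equivalent f34 _ _ = (τ ∘ˢ ρ , refl) , (τ ∘ˢ ρ , refl)
square-flags-equivalent f36 _ _ = (ρ ∘ˢ ρ ∘ˢ τ , refl) , (τ ∘ˢ ρ ∘ˢ ρ , refl)
square-flags-equivalent f38 _ _ = (ρ ∘ˢ τ , refl) , (ρ ∘ˢ τ , refl)
square-flags-equivalent f0 () _
square-flags-equivalent f1 () _
square-flags-equivalent f2 () _
square-flags-equivalent f3 () _
square-flags-equivalent f4 () _
square-flags-equivalent f5 () _
square-flags-equivalent f6 () _
square-flags-equivalent f7 () _
square-flags-equivalent f8 () _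
square-flags-equivalent f9 () _
square-flags-equivalent f10 () _
square-flags-equivalent f11 () _
square-flags-equivalent f12 () _
square-flags-equivalent f13 () _
square-flags-equivalent f14 () _
square-flags-equivalent f15 () _
square-flags-equivalent f16 () _
square-flags-equivalent f17 () _
square-flags-equivalent f18 () _
square-flags-equivalent f19 () _
square-flags-equivalent f20 () _
square-flags-equivalent f21 () _
square-flags-equivalent f22 () _
square-flags-equivalent f23 () _
square-flags-equivalent f24 _ ()
square-flags-equivalent f26 _ ()
square-flags-equivalent f28 _ ()
square-flags-equivalent f30 _ ()
square-flags-equivalent f33 _ ()
square-flags-equivalent f35 _ ()
square-flags-equivalent f37 _ ()
square-flags-equivalent f39 _ ()

mainTheorem7 : (Φ : Flag) → IsSquareTile (tileOf Φ) → IsSquareTile (tileOf (Φ · cbc))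
    → (w : Word) → InStab Φ w ⇔ InSubgroup 12 5 stabGen w
mainTheorem7 (x , y , k) tile-square cbc-tile-square w = mk⇔
  (λ Φw≡Φ → stabilizer⊆⟨stabGen⟩ (stabilizer-⇝ w k⇝base (stabilizer-fundamental w refl Φw≡Φ)))
  (λ w∈ → stabilizer-fundamental w refl (stabilizer-⇝ w base⇝k (⟨stabGen⟩⊆stabilizer-base w∈)))
  where
  k⇝base : k ⇝ f25
  k⇝base = proj₁ (square-flags-equivalent {x} {y} k tile-square cbc-tile-square)
  base⇝k : f25 ⇝ k
  base⇝k = proj₂ (square-flags-equivalent {x} {y} k tile-square cbc-tile-square)
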